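{- Let $s,k\ge 3$ be integers. Every pseudo-split graph that is a minimal $(s,k)$-polar obstruction has at most $s+k+3$ vertices, and this bound is tight.
   Context: All graphs are finite and simple. A graph $G$ is pseudo-split if $V_G$ has a partition $(C,S,I)$ with $C$ a clique, $I$ independent, $S=\varnothing$ or $G[S]\cong C_5$, $C$ completely adjacent to $S$, and no edges between $I$ and $S$. For nonnegative integers $s,k$, $G$ is $(s,k)$-polar if $V_G$ has a partition $(A,B)$ with $G[A]$ a complete multipartite graph with at most $s$ parts and $G[B]$ a disjoint union of at most $k$ complete graphs. A minimal $(s,k)$-polar obstruction is a graph that is not $(s,k)$-polar but every vertex-deleted subgraph of which is. -}

module Defs where

open import Data.Nat using (ℕ; zero; suc; pred)
open import Data.Fin using (Fin; zero; suc; punchIn)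
open import Data.Bool using (Bool; true; false)
open import Data.Product using (Σ; ∃; _×_; _,_)
open import Data.Sum using (_⊎_)
open import Relation.Nullary using (¬_)
open import Relation.Binary.PropositionalEquality using (_≡_; _≢_)
open import Function.Definitions using (Injective)

record Graph (n : ℕ) : Set where
  field
    E      : Fin n → Fin n → Bool
    sym    : ∀ i j → E i j ≡ E j i
    irrefl : ∀ i → E i i ≡ false

open Graph public

Adj : ∀ {n} → Graph n → Fin n → Fin n → Set
Adj G u v = E G u v ≡ true

delete : ∀ {n} → Graph n → Fin n → Graph (pred n)
delete {zero} G ()
delete {suc m} G v = record
  { E      = λ i j → E G (punchIn v i) (punchIn v j)
  ; sym    = λ i j → sym G (punchIn v i) (punchIn v j)
  ; irrefl = λ i → irrefl G (punchIn v i)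
  }

c5E : Fin 5 → Fin 5 → Bool
c5E zero (suc zero) = true
c5E (suc zero) (suc (suc zero)) = true
c5E (suc (suc zero)) (suc (suc (suc zero))) = true
c5E (suc (suc (suc zero))) (suc (suc (suc (suc zero)))) = true
c5E (suc (suc (suc (suc zero)))) zero = true
c5E (suc zero) zero = true
c5E (suc (suc zero)) (suc zero) = true
c5E (suc (suc (suc zero))) (suc (suc zero)) = true
c5E (suc (suc (suc (suc zero)))) (suc (suc (suc zero))) = true
c5E zero (suc (suc (suc (suc zero)))) = true
c5E _ _ = false

private
  c5sym : ∀ i j → c5E i j ≡ c5E j i
  c5sym zero zero = _≡_.refl
  c5sym zero (suc zero) = _≡_.refl
  c5sym zero (suc (suc zero)) = _≡_.refl
  c5sym zero (suc (suc (suc zero))) = _≡_.refl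
  c5sym zero (suc (suc (suc (suc zero)))) = _≡_.refl
  c5sym (suc zero) zero = _≡_.refl
  c5sym (suc zero) (suc zero) = _≡_.refl
  c5sym (suc zero) (suc (suc zero)) = _≡_.refl
  c5sym (suc zero) (suc (suc (suc zero))) = _≡_.refl
  c5sym (suc zero) (suc (suc (suc (suc zero)))) = _≡_.refl
  c5sym (suc (suc zero)) zero = _≡_.refl
  c5sym (suc (suc zero)) (suc zero) = _≡_.refl
  c5sym (suc (suc zero)) (suc (suc zero)) = _≡_.refl
  c5sym (suc (suc zero)) (suc (suc (suc zero))) = _≡_.refl
  c5sym (suc (suc zero)) (suc (suc (suc (suc zero)))) = _≡_.refl
  c5sym (suc (suc (suc zero))) zero = _≡_.refl
  c5sym (suc (suc (suc zero))) (suc zero) = _≡_.refl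
  c5sym (suc (suc (suc zero))) (suc (suc zero)) = _≡_.refl
  c5sym (suc (suc (suc zero))) (suc (suc (suc zero))) = _≡_.refl
  c5sym (suc (suc (suc zero))) (suc (suc (suc (suc zero)))) = _≡_.refl
  c5sym (suc (suc (suc (suc zero)))) zero = _≡_.refl
  c5sym (suc (suc (suc (suc zero)))) (suc zero) = _≡_.refl
  c5sym (suc (suc (suc (suc zero)))) (suc (suc zero)) = _≡_.refl
  c5sym (suc (suc (suc (suc zero)))) (suc (suc (suc zero))) = _≡_.refl
  c5sym (suc (suc (suc (suc zero)))) (suc (suc (suc (suc zero)))) = _≡_.refl

  c5irr : ∀ i → c5E i i ≡ false
  c5irr zero = _≡_.refl
  c5irr (suc zero) = _≡_.refl
  c5irr (suc (suc zero)) = _≡_.refl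
  c5irr (suc (suc (suc zero))) = _≡_.refl
  c5irr (suc (suc (suc (suc zero)))) = _≡_.refl

C5 : Graph 5
C5 = record { E = c5E ; sym = c5sym ; irrefl = c5irr }

InducedIso : ∀ {n m} → Graph n → (Fin n → Set) → Graph m → Set
InducedIso {n} {m} G X H =
  Σ (Fin m → Fin n) λ g →
    Injective _≡_ _≡_ g
    × (∀ i → X (g i))
    × (∀ v → X v → ∃ λ i → g i ≡ v)
    × (∀ i j → E G (g i) (g j) ≡ E H i j)

data Part : Set where
  C S I : Part

PseudoSplit : ∀ {n} → Graph n → Set
PseudoSplit {n} G =
  Σ (Fin n → Part) λ p →
    (∀ u v → p u ≡ C → p v ≡ C → u ≢ v → Adj G u v)
    × (∀ u v → p u ≡ I → p v ≡ I → ¬ Adj G u v)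
    × ((∀ v → p v ≢ S) ⊎ InducedIso G (λ v → p v ≡ S) C5)
    × (∀ u v → p u ≡ C → p v ≡ S → Adj G u v)
    × (∀ u v → p u ≡ I → p v ≡ S → ¬ Adj G u v)

-- G is (s,k)-polar: a partition (A,B) of V(G) (side true = A, false = B)
-- such that G[A] is complete multipartite with at most s parts (vertices of
-- A are assigned a part in Fin s; distinct vertices of A are adjacent iff
-- they lie in different parts) and G[B] is a disjoint union of at most k
-- complete graphs (vertices of B are assigned a component in Fin k;
-- distinct vertices of B are adjacent iff they lie in the same component).
Polar : ℕ → ℕ → ∀ {n} → Graph n → Set
Polar s k {n} G =
  Σ (Fin n → Bool) λ side →
    (Σ (Fin n → Fin s) λ a →
       ∀ u v → side u ≡ true → side v ≡ true → u ≢ v →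
         (Adj G u v → a u ≢ a v) × (a u ≢ a v → Adj G u v))
    × (Σ (Fin n → Fin k) λ b →
       ∀ u v → side u ≡ false → side v ≡ false → u ≢ v →
         (Adj G u v → b u ≡ b v) × (b u ≡ b v → Adj G u v))

MinimalObstruction : ℕ → ℕ → ∀ {n} → Graph n → Set
MinimalObstruction s k G = ¬ Polar s k G × (∀ v → Polar s k (delete G v))

{-# OPTIONS --safe #-}

-- If S = ∅ the graph is split, hence polar, so G[S] ≅ C₅. Let C⁺ X be the
-- vertices of C ∩ X with a neighbour in I ∩ X, and I⁻ X those of I ∩ X with a
-- non-neighbour in C ∩ X. For X ⊇ S, G[X] is (s,k)-polar iff it has type 1
-- (|I ∩ X| < k and |C⁺ X| + 2 ≤ s) or type 2 (|C ∩ X| < s and |I⁻ X| + 2 ≤ k).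
-- Indeed the C₅ lies neither inside the multipartite side A nor inside the side B
-- of cliques, so A contains an edge of it and B a vertex, or A a vertex and B a
-- non-edge; this forces I ∩ X ⊆ B and C⁺ X ⊆ A, resp. C ∩ X ⊆ A and I⁻ X ⊆ B, and
-- conversely both types admit explicit polar partitions. Deleting a vertex of S
-- leaves a split graph. In a minimal obstruction G has neither type while every
-- deletion of a vertex of C or I has one; comparing counts before and after a
-- deletion gives |C| ≤ s and |I| ≤ k, and rules out |C| = s with |I| ≥ k - 1 as
-- well as |C| ≥ s - 1 with |I| = k. Hence |C| + |I| + 2 ≤ s + k.

module Submission where

open import Defs renaming (sym to E-sym)
import Data.Nat as ℕ
open import Data.Nat using (ℕ; zero; suc; _≤_; _<_; _+_; z≤n; s≤s; NonZero; >-nonZero; >-nonZero⁻¹)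
open import Data.Nat.Properties
  using (≤-reflexive; ≤-trans; ≤-pred; <⇒≤; ≰⇒>; <-irrefl; <⇒≢; _≤?_; n≤1+n; m≤m+n;
         +-suc; +-comm; +-mono-≤; +-monoʳ-≤; +-cancelˡ-≤; +-cancelˡ-≡; module ≤-Reasoning)
open import Data.Nat.DivMod using (_mod_; _%_; m<n⇒m%n≡m)
open import Data.Nat.Solver using (module +-*-Solver)
open import Data.Fin using (Fin; zero; suc; toℕ; fromℕ<; #_; punchIn; punchOut; splitAt; join)
open import Data.Fin.Properties
  using (all?; injective⇒≤; suc-injective; toℕ-fromℕ<; punchInᵢ≢i; punchIn-injective; punchIn-punchOut;
         punchOut-punchIn; punchOut-cong; splitAt-↑ˡ; splitAt-↑ʳ; splitAt-join; join-splitAt)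
  renaming (_≟_ to _≟ᶠ_)
open import Data.Bool using (Bool; true; false; _∧_; _∨_; not; if_then_else_)
open import Data.Bool.Properties using (∨-zeroʳ) renaming (_≟_ to _≟ᵇ_)
open import Data.Product using (Σ; ∃; _×_; _,_; proj₁; proj₂)
open import Data.Sum using (_⊎_; inj₁; inj₂; map₂)
open import Data.Sum.Properties using (inj₁-injective; inj₂-injective)
open import Data.Empty using (⊥; ⊥-elim)
open import Function using (_∘_)
open import Function.Definitions using (Injective)
open import Function.Bundles using (mk⇔)
open import Relation.Nullary using (¬_; yes; no; does)
open import Relation.Nullary.Decidable using (does-⇔; dec-true; dec-false; from-yes; _→-dec_; ¬?)
open import Relation.Binary.PropositionalEquality

-- Boolean vertex sets and their sizes

∧-true⁻ : ∀ {a b} → a ∧ b ≡ true → a ≡ true × b ≡ true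
∧-true⁻ {true} b = refl , b

∧-true⁺ : ∀ {a b} → a ≡ true → b ≡ true → a ∧ b ≡ true
∧-true⁺ refl b = b

not-true : ∀ {a} → not a ≡ true → a ≡ false
not-true {false} _ = refl

not-false : ∀ {a} → not a ≡ false → a ≡ true
not-false {true} _ = refl

∨-true⁻ : ∀ {a b} → a ∨ b ≡ true → a ≡ true ⊎ b ≡ true
∨-true⁻ {true}  _ = inj₁ refl
∨-true⁻ {false} b = inj₂ b

module _ {n : ℕ} where

  _⊆_ : (Fin n → Bool) → (Fin n → Bool) → Set
  P ⊆ Q = ∀ x → P x ≡ true → Q x ≡ true

  full : Fin n → Bool
  full _ = true

  _-_ : (Fin n → Bool) → Fin n → (Fin n → Bool)
  (P - y) x = not (does (y ≟ᶠ x)) ∧ P x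

  insert : Fin n → (Fin n → Bool) → (Fin n → Bool)
  insert y P x = does (y ≟ᶠ x) ∨ P x

module _ {n : ℕ} {P : Fin n → Bool} {y x : Fin n} where

  ∈-delete⁻ : (P - y) x ≡ true → P x ≡ true × x ≢ y
  ∈-delete⁻ h with y ≟ᶠ x
  ... | no y≢x = h , λ x≡y → y≢x (sym x≡y)

  ∈-delete⁺ : P x ≡ true → x ≢ y → (P - y) x ≡ true
  ∈-delete⁺ Px x≢y rewrite dec-false (y ≟ᶠ x) (λ y≡x → x≢y (sym y≡x)) = Px

  ∈-insert⁻ : insert y P x ≡ true → x ≡ y ⊎ P x ≡ true
  ∈-insert⁻ h with y ≟ᶠ x
  ... | yes refl = inj₁ refl
  ... | no _     = inj₂ h

  ∉-insert : y ≢ x → P x ≡ false → insert y P x ≡ false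
  ∉-insert y≢x Px rewrite dec-false (y ≟ᶠ x) y≢x = Px

module _ {n : ℕ} where

  delete-⊆ : ∀ {P : Fin n → Bool} {y} → (P - y) ⊆ P
  delete-⊆ {P} {y} _ x∈ = proj₁ (∈-delete⁻ {P = P} {y} x∈)

  ⊆-trans : {P Q R : Fin n → Bool} → P ⊆ Q → Q ⊆ R → P ⊆ R
  ⊆-trans P⊆Q Q⊆R x = Q⊆R x ∘ P⊆Q x

  insert-all : ∀ {ℓ} {Q : Fin n → Bool} {y} (R : Fin n → Set ℓ) → R y → (∀ {x} → Q x ≡ true → R x) →
    ∀ {x} → insert y Q x ≡ true → R x
  insert-all {Q = Q} {y} R Ry RQ {x} h with ∈-insert⁻ {P = Q} {y} h
  ... | inj₁ refl = Ry
  ... | inj₂ Qx   = RQ Qx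

count : ∀ {n} → (Fin n → Bool) → ℕ
count {zero}  P = 0
count {suc n} P = if P zero then suc (count (P ∘ suc)) else count (P ∘ suc)

count-mono : ∀ {n} {P Q : Fin n → Bool} → P ⊆ Q → count P ≤ count Q
count-mono {zero} P⊆Q = z≤n
count-mono {suc n} {P} {Q} P⊆Q with P zero in P0 | Q zero in Q0
... | true  | true  = s≤s (count-mono (P⊆Q ∘ suc))
... | false | true  = ≤-trans (count-mono (P⊆Q ∘ suc)) (n≤1+n _)
... | false | false = count-mono (P⊆Q ∘ suc)
... | true  | false with () ← trans (sym Q0) (P⊆Q zero P0)

count-full : ∀ {n} → count (full {n}) ≡ n
count-full {zero} = refl
count-full {suc n} = cong suc (count-full {n})

count-∪ : ∀ {n} (P Q : Fin n → Bool) → count (λ x → P x ∨ Q x) ≤ count P + count Q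
count-∪ {zero} P Q = z≤n
count-∪ {suc n} P Q with P zero | Q zero
... | true  | true  =
  s≤s (≤-trans (count-∪ (P ∘ suc) (Q ∘ suc)) (≤-trans (n≤1+n _) (≤-reflexive (sym (+-suc _ _)))))
... | true  | false = s≤s (count-∪ (P ∘ suc) (Q ∘ suc))
... | false | true  = ≤-trans (s≤s (count-∪ (P ∘ suc) (Q ∘ suc))) (≤-reflexive (sym (+-suc _ _)))
... | false | false = count-∪ (P ∘ suc) (Q ∘ suc)

count-insert : ∀ {n} (P : Fin n → Bool) y → P y ≡ false → count (insert y P) ≡ suc (count P)
count-insert {suc n} P zero    Py rewrite Py = refl
count-insert {suc n} P (suc y) Py with P zero
... | true  = cong suc (count-insert (P ∘ suc) y Py)
... | false = count-insert (P ∘ suc) y Py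

count-delete-∈ : ∀ {n} (P : Fin n → Bool) y → P y ≡ true → suc (count (P - y)) ≡ count P
count-delete-∈ {suc n} P zero    Py rewrite Py = refl
count-delete-∈ {suc n} P (suc y) Py with P zero
... | true  = cong suc (count-delete-∈ (P ∘ suc) y Py)
... | false = count-delete-∈ (P ∘ suc) y Py

count-delete-∉ : ∀ {n} (P : Fin n → Bool) y → P y ≡ false → count (P - y) ≡ count P
count-delete-∉ {suc n} P zero    Py rewrite Py = refl
count-delete-∉ {suc n} P (suc y) Py with P zero
... | true  = cong suc (count-delete-∉ (P ∘ suc) y Py)
... | false = count-delete-∉ (P ∘ suc) y Py

count≤suc-count-delete : ∀ {n} (P : Fin n → Bool) y → count P ≤ suc (count (P - y))
count≤suc-count-delete P y with P y in Py
... | true  = ≤-reflexive (sym (count-delete-∈ P y Py))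
... | false = ≤-trans (≤-reflexive (sym (count-delete-∉ P y Py))) (n≤1+n _)

count≤suc-count-⊇delete : ∀ {n} {P Q : Fin n → Bool} y → (P - y) ⊆ Q → count P ≤ suc (count Q)
count≤suc-count-⊇delete {P = P} y P-y⊆Q = ≤-trans (count≤suc-count-delete P y) (s≤s (count-mono P-y⊆Q))

count≤count-⊇delete : ∀ {n} {P Q : Fin n → Bool} y → P y ≡ false → (P - y) ⊆ Q → count P ≤ count Q
count≤count-⊇delete {P = P} y Py P-y⊆Q =
  ≤-trans (≤-reflexive (sym (count-delete-∉ P y Py))) (count-mono P-y⊆Q)

count>0⇒member : ∀ {n} (P : Fin n → Bool) → 0 < count P → ∃ λ x → P x ≡ true
count>0⇒member {suc n} P pos with P zero in P0
... | true  = zero , P0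
... | false with x , Px ← count>0⇒member (P ∘ suc) pos = suc x , Px

count≥2⇒other-member : ∀ {n} (P : Fin n → Bool) → 2 ≤ count P → ∀ y → ∃ λ x → P x ≡ true × x ≢ y
count≥2⇒other-member P two y
  with x , Px-y ← count>0⇒member (P - y) (≤-pred (≤-trans two (count≤suc-count-delete P y)))
  = x , ∈-delete⁻ {P = P} Px-y

enumerate : ∀ {n} (P : Fin n → Bool) → Fin (count P) → Fin n
enumerate {suc n} P i with P zero
enumerate {suc n} P zero    | true  = zero
enumerate {suc n} P (suc i) | true  = suc (enumerate (P ∘ suc) i)
enumerate {suc n} P i       | false = suc (enumerate (P ∘ suc) i)

enumerate-member : ∀ {n} (P : Fin n → Bool) i → P (enumerate P i) ≡ true
enumerate-member {suc n} P i with P zero in P0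
enumerate-member {suc n} P zero    | true  = P0
enumerate-member {suc n} P (suc i) | true  = enumerate-member (P ∘ suc) i
enumerate-member {suc n} P i       | false = enumerate-member (P ∘ suc) i

enumerate-injective : ∀ {n} (P : Fin n → Bool) {i j} → enumerate P i ≡ enumerate P j → i ≡ j
enumerate-injective {suc n} P {i} {j} e with P zero
enumerate-injective {suc n} P {zero}  {zero}  e | true = refl
enumerate-injective {suc n} P {suc i} {suc j} e | true = cong suc (enumerate-injective (P ∘ suc) (suc-injective e))
enumerate-injective {suc n} P {i}     {j}     e | false = enumerate-injective (P ∘ suc) (suc-injective e)

count-injection : ∀ {n m} (P : Fin n → Bool) (f : Fin n → Fin m) →
  (∀ {x y} → P x ≡ true → P y ≡ true → f x ≡ f y → x ≡ y) → count P ≤ m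
count-injection P f f-inj =
  injective⇒≤ (λ e → enumerate-injective P (f-inj (enumerate-member P _) (enumerate-member P _) e))

count-⊂ : ∀ {n} {P Q : Fin n → Bool} y → Q ⊆ (P - y) → P y ≡ true → count Q < count P
count-⊂ {P = P} y Q⊆P-y Py = ≤-trans (s≤s (count-mono Q⊆P-y)) (≤-reflexive (count-delete-∈ P y Py))

rank : ∀ {n} (P : Fin n → Bool) → Fin n → ℕ
rank P zero    = 0
rank P (suc x) = if P zero then suc (rank (P ∘ suc) x) else rank (P ∘ suc) x

rank<count : ∀ {n} (P : Fin n → Bool) {x} → P x ≡ true → rank P x < count P
rank<count P {zero}  Px rewrite Px = s≤s z≤n
rank<count P {suc x} Px with P zero
... | true  = s≤s (rank<count (P ∘ suc) Px)
... | false = rank<count (P ∘ suc) Px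

rank-injective : ∀ {n} (P : Fin n → Bool) {x y} → P x ≡ true → P y ≡ true → rank P x ≡ rank P y → x ≡ y
rank-injective P {zero}  {zero}  _  _  _ = refl
rank-injective P {zero}  {suc y} Px _  e rewrite Px with () ← e
rank-injective P {suc x} {zero}  _  Py e rewrite Py with () ← e
rank-injective P {suc x} {suc y} Px Py e with P zero
... | true  = cong suc (rank-injective (P ∘ suc) Px Py (+-cancelˡ-≡ 1 _ _ e))
... | false = cong suc (rank-injective (P ∘ suc) Px Py e)

injection⇒≤count : ∀ {m n} (P : Fin n → Bool) (f : Fin m → Fin n) → Injective _≡_ _≡_ f →
  (∀ j → P (f j) ≡ true) → m ≤ count P
injection⇒≤count P f f-injective P∘f =
  injective⇒≤ {f = λ j → fromℕ< (rank<count P (P∘f j))} λ {j} {j′} e →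
  f-injective (rank-injective P (P∘f j) (P∘f j′)
    (trans (sym (toℕ-fromℕ< _)) (trans (cong toℕ e) (toℕ-fromℕ< _))))

anyᵇ : ∀ {n} → (Fin n → Bool) → Bool
anyᵇ {zero}  P = false
anyᵇ {suc n} P = P zero ∨ anyᵇ (P ∘ suc)

anyᵇ-intro : ∀ {n} (P : Fin n → Bool) x → P x ≡ true → anyᵇ P ≡ true
anyᵇ-intro P zero    Px rewrite Px = refl
anyᵇ-intro P (suc x) Px rewrite anyᵇ-intro (P ∘ suc) x Px = ∨-zeroʳ (P zero)

anyᵇ-elim : ∀ {n} (P : Fin n → Bool) → anyᵇ P ≡ true → ∃ λ x → P x ≡ true
anyᵇ-elim {suc n} P h with ∨-true⁻ {P zero} h
... | inj₁ P0 = zero , P0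
... | inj₂ h′ with x , Px ← anyᵇ-elim (P ∘ suc) h′ = suc x , Px

module _ {n : ℕ} (G : Graph n) where

  Clique : (Fin n → Bool) → Set
  Clique Q = ∀ {x y} → Q x ≡ true → Q y ≡ true → x ≢ y → Adj G x y

  Independent : (Fin n → Bool) → Set
  Independent Q = ∀ {x y} → Q x ≡ true → Q y ≡ true → ¬ Adj G x y

  Adj⇒≢ : ∀ {x y} → Adj G x y → x ≢ y
  Adj⇒≢ {x} xy refl with () ← trans (sym xy) (irrefl G x)

  Adj-sym : ∀ {x y} → Adj G x y → Adj G y x
  Adj-sym {x} {y} xy = trans (E-sym G y x) xy

  ¬Adj⇒E≡false : ∀ {x y} → ¬ Adj G x y → E G x y ≡ false
  ¬Adj⇒E≡false {x} {y} ¬xy with E G x y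
  ... | true  = ⊥-elim (¬xy refl)
  ... | false = refl

  E≡false⇒¬Adj : ∀ {x y} → E G x y ≡ false → ¬ Adj G x y
  E≡false⇒¬Adj xy≡false xy with () ← trans (sym xy) xy≡false

  clique-insert : ∀ {Q y} → Clique Q → (∀ {x} → Q x ≡ true → x ≢ y → Adj G y x) → Clique (insert y Q)
  clique-insert {Q} {y} cl y~Q {x} {x′} Qx Qx′ x≢x′ with ∈-insert⁻ {P = Q} {y} Qx | ∈-insert⁻ {P = Q} {y} Qx′
  ... | inj₁ refl | inj₁ refl = ⊥-elim (x≢x′ refl)
  ... | inj₁ refl | inj₂ Qx″  = y~Q Qx″ (x≢x′ ∘ sym)
  ... | inj₂ Qx″  | inj₁ refl = Adj-sym (y~Q Qx″ x≢x′)
  ... | inj₂ Qx″  | inj₂ Qx‴  = cl Qx″ Qx‴ x≢x′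

  independent-insert : ∀ {Q y} → Independent Q → (∀ {x} → Q x ≡ true → ¬ Adj G y x) → Independent (insert y Q)
  independent-insert {Q} {y} ind y≁Q {x} {x′} Qx Qx′ with ∈-insert⁻ {P = Q} {y} Qx | ∈-insert⁻ {P = Q} {y} Qx′
  ... | inj₁ refl | inj₁ refl = λ yy → Adj⇒≢ yy refl
  ... | inj₁ refl | inj₂ Qx″  = y≁Q Qx″
  ... | inj₂ Qx″  | inj₁ refl = y≁Q Qx″ ∘ Adj-sym
  ... | inj₂ Qx″  | inj₂ Qx‴  = ind Qx″ Qx‴

-- Polar partitions of induced subgraphs

PolarOn : ℕ → ℕ → ∀ {n} → Graph n → (Fin n → Bool) → Set
PolarOn s k {n} G X =
  Σ (Fin n → Bool) λ side →
    (Σ (Fin n → Fin s) λ a →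
       ∀ u v → X u ≡ true → X v ≡ true → side u ≡ true → side v ≡ true → u ≢ v →
         (Adj G u v → a u ≢ a v) × (a u ≢ a v → Adj G u v))
    × (Σ (Fin n → Fin k) λ b →
       ∀ u v → X u ≡ true → X v ≡ true → side u ≡ false → side v ≡ false → u ≢ v →
         (Adj G u v → b u ≡ b v) × (b u ≡ b v → Adj G u v))

module _ {s k n : ℕ} (G : Graph n) where

  polar⇒polarOn-full : Polar s k G → PolarOn s k G full
  polar⇒polarOn-full (side , (a , ha) , (b , hb)) =
    side , (a , λ u v _ _ → ha u v) , (b , λ u v _ _ → hb u v)

  polarOn-full⇒polar : PolarOn s k G full → Polar s k G
  polarOn-full⇒polar (side , (a , ha) , (b , hb)) =
    side , (a , λ u v → ha u v refl refl) , (b , λ u v → hb u v refl refl)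

module _ {n : ℕ} (v : Fin (suc n)) where

  punchIn-∈-delete : ∀ x → (full - v) (punchIn v x) ≡ true
  punchIn-∈-delete x = ∈-delete⁺ {P = full} refl (punchInᵢ≢i v x)

  data PunchedIn : Fin (suc n) → Set where
    punchedIn : ∀ x → PunchedIn (punchIn v x)

  punchedIn-view : ∀ {u} → (full - v) u ≡ true → PunchedIn u
  punchedIn-view u∈ =
    subst PunchedIn (punchIn-punchOut (proj₂ (∈-delete⁻ {P = full} u∈) ∘ sym)) (punchedIn _)

  extend : ∀ {A : Set} → A → (Fin n → A) → Fin (suc n) → A
  extend d f u with v ≟ᶠ u
  ... | yes _   = d
  ... | no v≢u = f (punchOut v≢u)

  extend-punchIn : ∀ {A : Set} (d : A) f x → extend d f (punchIn v x) ≡ f x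
  extend-punchIn d f x with v ≟ᶠ punchIn v x
  ... | yes v≡ = ⊥-elim (punchInᵢ≢i v x (sym v≡))
  ... | no v≢  = cong f (trans (punchOut-cong v refl) (punchOut-punchIn v))

module _ {s k n : ℕ} (G : Graph (suc n)) (v : Fin (suc n)) where

  polarOn-delete⇒polar : PolarOn s k G (full - v) → Polar s k (delete G v)
  polarOn-delete⇒polar (side , (a , ha) , (b , hb)) =
    side ∘ punchIn v ,
    (a ∘ punchIn v , λ x y sx sy x≢y →
       ha _ _ (punchIn-∈-delete v x) (punchIn-∈-delete v y) sx sy (x≢y ∘ punchIn-injective v x y)) ,
    (b ∘ punchIn v , λ x y sx sy x≢y →
       hb _ _ (punchIn-∈-delete v x) (punchIn-∈-delete v y) sx sy (x≢y ∘ punchIn-injective v x y))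

  polar-delete⇒polarOn : .{{NonZero s}} → .{{NonZero k}} → Polar s k (delete G v) → PolarOn s k G (full - v)
  polar-delete⇒polarOn (side , (a , ha) , (b , hb)) = side′ , (a′ , A-part) , (b′ , B-part)
    where
    side′ : Fin (suc n) → Bool
    side′ = extend v true side
    a′ : Fin (suc n) → Fin s
    a′ = extend v (0 mod s) a
    b′ : Fin (suc n) → Fin k
    b′ = extend v (0 mod k) b

    A-part : ∀ u w → (full - v) u ≡ true → (full - v) w ≡ true →
             side′ u ≡ true → side′ w ≡ true → u ≢ w →
             (Adj G u w → a′ u ≢ a′ w) × (a′ u ≢ a′ w → Adj G u w)
    A-part u w u∈ w∈ su sw u≢w with punchedIn-view v u∈ | punchedIn-view v w∈
    ... | punchedIn x | punchedIn y
      rewrite extend-punchIn v true side x | extend-punchIn v true side y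
            | extend-punchIn v (0 mod s) a x | extend-punchIn v (0 mod s) a y
      = ha x y su sw (u≢w ∘ cong (punchIn v))

    B-part : ∀ u w → (full - v) u ≡ true → (full - v) w ≡ true →
             side′ u ≡ false → side′ w ≡ false → u ≢ w →
             (Adj G u w → b′ u ≡ b′ w) × (b′ u ≡ b′ w → Adj G u w)
    B-part u w u∈ w∈ su sw u≢w with punchedIn-view v u∈ | punchedIn-view v w∈
    ... | punchedIn x | punchedIn y
      rewrite extend-punchIn v true side x | extend-punchIn v true side y
            | extend-punchIn v (0 mod k) b x | extend-punchIn v (0 mod k) b y
      = hb x y su sw (u≢w ∘ cong (punchIn v))

module PolarPartition {s k n : ℕ} {G : Graph n} {X : Fin n → Bool} (P : PolarOn s k G X) where

  side : Fin n → Bool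
  side = proj₁ P

  InA InB : Fin n → Set
  InA u = X u ≡ true × side u ≡ true
  InB u = X u ≡ true × side u ≡ false

  private
    a : Fin n → Fin s
    a = proj₁ (proj₁ (proj₂ P))

    b : Fin n → Fin k
    b = proj₁ (proj₂ (proj₂ P))

    a-spec : ∀ {u v} → InA u → InA v → u ≢ v → (Adj G u v → a u ≢ a v) × (a u ≢ a v → Adj G u v)
    a-spec {u} {v} (Xu , su) (Xv , sv) = proj₂ (proj₁ (proj₂ P)) u v Xu Xv su sv

    b-spec : ∀ {u v} → InB u → InB v → u ≢ v → (Adj G u v → b u ≡ b v) × (b u ≡ b v → Adj G u v)
    b-spec {u} {v} (Xu , su) (Xv , sv) = proj₂ (proj₂ (proj₂ P)) u v Xu Xv su sv

    ¬Adj⇒same-part : ∀ {u v} → InA u → InA v → u ≢ v → ¬ Adj G u v → a u ≡ a v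
    ¬Adj⇒same-part {u} {v} Au Av u≢v ¬uv with a u ≟ᶠ a v
    ... | yes same = same
    ... | no  diff = ⊥-elim (¬uv (proj₂ (a-spec Au Av u≢v) diff))

    Adj⇒same-clique : ∀ {u v} → InB u → InB v → Adj G u v → b u ≡ b v
    Adj⇒same-clique Bu Bv uv = proj₁ (b-spec Bu Bv (Adj⇒≢ G uv)) uv

  A-nonadjacency-transitive : ∀ {u v w} → InA u → InA v → InA w → ¬ Adj G w u → ¬ Adj G w v → ¬ Adj G u v
  A-nonadjacency-transitive Au Av Aw ¬wu ¬wv uv =
    proj₁ (a-spec Au Av (Adj⇒≢ G uv)) uv
      (trans (sym (¬Adj⇒same-part Aw Au (λ { refl → ¬wv uv }) ¬wu))
             (¬Adj⇒same-part Aw Av (λ { refl → ¬wu (Adj-sym G uv) }) ¬wv))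

  B-adjacency-transitive : ∀ {u v w} → InB u → InB v → InB w → Adj G w u → Adj G w v → u ≢ v → Adj G u v
  B-adjacency-transitive Bu Bv Bw wu wv u≢v =
    proj₂ (b-spec Bu Bv u≢v) (trans (sym (Adj⇒same-clique Bw Bu wu)) (Adj⇒same-clique Bw Bv wv))

  A-clique-bound : ∀ {Q} → (∀ {x} → Q x ≡ true → InA x) → Clique G Q → count Q ≤ s
  A-clique-bound {Q} Q⊆A cl = count-injection Q a a-injective
    where
    a-injective : ∀ {x y} → Q x ≡ true → Q y ≡ true → a x ≡ a y → x ≡ y
    a-injective {x} {y} Qx Qy ax≡ay with x ≟ᶠ y
    ... | yes x≡y = x≡y
    ... | no  x≢y = ⊥-elim (proj₁ (a-spec (Q⊆A Qx) (Q⊆A Qy) x≢y) (cl Qx Qy x≢y) ax≡ay)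

  B-independent-bound : ∀ {Q} → (∀ {x} → Q x ≡ true → InB x) → Independent G Q → count Q ≤ k
  B-independent-bound {Q} Q⊆B ind = count-injection Q b b-injective
    where
    b-injective : ∀ {x y} → Q x ≡ true → Q y ≡ true → b x ≡ b y → x ≡ y
    b-injective {x} {y} Qx Qy bx≡by with x ≟ᶠ y
    ... | yes x≡y = x≡y
    ... | no  x≢y = ⊥-elim (ind Qx Qy (proj₂ (b-spec (Q⊆B Qx) (Q⊆B Qy) x≢y) bx≡by))

mod-injective : ∀ {m₁ m₂ d} .{{_ : NonZero d}} → m₁ < d → m₂ < d → m₁ mod d ≡ m₂ mod d → m₁ ≡ m₂
mod-injective {m₁} {m₂} {d} m₁<d m₂<d e = begin
  m₁               ≡⟨ sym (m<n⇒m%n≡m m₁<d) ⟩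
  m₁ % d           ≡⟨ sym (toℕ-fromℕ< _) ⟩
  toℕ (m₁ mod d)   ≡⟨ cong toℕ e ⟩
  toℕ (m₂ mod d)   ≡⟨ toℕ-fromℕ< _ ⟩
  m₂ % d           ≡⟨ m<n⇒m%n≡m m₂<d ⟩
  m₂               ∎
  where open ≡-Reasoning

different-labels : ∀ {m₁ m₂} → m₁ ≢ m₂ → not (does (m₁ ℕ.≟ m₂)) ≡ true
different-labels m₁≢m₂ = cong not (dec-false (_ ℕ.≟ _) m₁≢m₂)

<2⇒≢2+ : ∀ {m} r → m < 2 → m ≢ 2 + r
<2⇒≢2+ r m<2 = <⇒≢ (≤-trans m<2 (m≤m+n 2 r))

module _ {s k n : ℕ} .{{_ : NonZero s}} .{{_ : NonZero k}} (G : Graph n) (X : Fin n → Bool)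
         (side : Fin n → Bool) (α β : Fin n → ℕ) where

  polarOn-by-labels :
    (∀ {u} → X u ≡ true → side u ≡ true → α u < s) →
    (∀ {u} → X u ≡ true → side u ≡ false → β u < k) →
    (∀ {u v} → X u ≡ true → X v ≡ true → side u ≡ true → side v ≡ true → u ≢ v →
       E G u v ≡ not (does (α u ℕ.≟ α v))) →
    (∀ {u v} → X u ≡ true → X v ≡ true → side u ≡ false → side v ≡ false → u ≢ v →
       E G u v ≡ does (β u ℕ.≟ β v)) →
    PolarOn s k G X
  polarOn-by-labels α<s β<k E-on-A E-on-B =
    side , ((λ u → α u mod s) , A-part) , ((λ u → β u mod k) , B-part)
    where
    A-part : ∀ u v → X u ≡ true → X v ≡ true → side u ≡ true → side v ≡ true → u ≢ v →
             (Adj G u v → α u mod s ≢ α v mod s) × (α u mod s ≢ α v mod s → Adj G u v)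
    A-part u v Xu Xv su sv u≢v with α u ℕ.≟ α v
    ... | yes αu≡αv = (λ uv _ → E≡false⇒¬Adj G uv≡false uv) , (λ different → ⊥-elim (different (cong (_mod s) αu≡αv)))
      where uv≡false : E G u v ≡ false
            uv≡false = trans (E-on-A Xu Xv su sv u≢v) (cong not (dec-true (α u ℕ.≟ α v) αu≡αv))
    ... | no  αu≢αv = (λ _ same → αu≢αv (mod-injective (α<s Xu su) (α<s Xv sv) same)) ,
                      (λ _ → trans (E-on-A Xu Xv su sv u≢v) (cong not (dec-false (α u ℕ.≟ α v) αu≢αv)))

    B-part : ∀ u v → X u ≡ true → X v ≡ true → side u ≡ false → side v ≡ false → u ≢ v →
             (Adj G u v → β u mod k ≡ β v mod k) × (β u mod k ≡ β v mod k → Adj G u v)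
    B-part u v Xu Xv su sv u≢v with β u ℕ.≟ β v
    ... | yes βu≡βv = (λ _ → cong (_mod k) βu≡βv) ,
                      (λ _ → trans (E-on-B Xu Xv su sv u≢v) (dec-true (β u ℕ.≟ β v) βu≡βv))
    ... | no  βu≢βv = (λ uv → ⊥-elim (E≡false⇒¬Adj G uv≡false uv)) ,
                      (λ same → ⊥-elim (βu≢βv (mod-injective (β<k Xu su) (β<k Xv sv) same)))
      where uv≡false : E G u v ≡ false
            uv≡false = trans (E-on-B Xu Xv su sv u≢v) (dec-false (β u ℕ.≟ β v) βu≢βv)

-- The five-cycle

data C₅-Colouring (σ : Fin 5 → Bool) : Set where
  true-edge : ∀ {a₁ a₂ b} → σ a₁ ≡ true → σ a₂ ≡ true → Adj C5 a₁ a₂ → σ b ≡ false → C₅-Colouring σ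
  true-vertex-false-non-edge : ∀ {a b₁ b₂} → σ a ≡ true → σ b₁ ≡ false → σ b₂ ≡ false →
    b₁ ≢ b₂ → ¬ Adj C5 b₁ b₂ → C₅-Colouring σ
  true-co-P₃ : σ (# 0) ≡ true → σ (# 1) ≡ true → σ (# 3) ≡ true → C₅-Colouring σ
  false-P₃ : σ (# 0) ≡ false → σ (# 1) ≡ false → σ (# 2) ≡ false → C₅-Colouring σ

C₅-colouring : ∀ σ → C₅-Colouring σ
C₅-colouring σ with σ (# 0) in σ₀ | σ (# 1) in σ₁
... | true  | true  with σ (# 3) in σ₃
...   | true  = true-co-P₃ σ₀ σ₁ σ₃
...   | false = true-edge σ₀ σ₁ refl σ₃
C₅-colouring σ | true  | false with σ (# 4) in σ₄
...   | true  = true-edge {a₁ = # 0} {a₂ = # 4} σ₀ σ₄ refl σ₁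
...   | false = true-vertex-false-non-edge {a = # 0} {b₁ = # 1} {b₂ = # 4} σ₀ σ₁ σ₄ (λ ()) (λ ())
C₅-colouring σ | false | true  with σ (# 2) in σ₂
...   | true  = true-edge {a₁ = # 1} {a₂ = # 2} σ₁ σ₂ refl σ₀
...   | false = true-vertex-false-non-edge {a = # 1} {b₁ = # 0} {b₂ = # 2} σ₁ σ₀ σ₂ (λ ()) (λ ())
C₅-colouring σ | false | false with σ (# 2) in σ₂
...   | false = false-P₃ σ₀ σ₁ σ₂
...   | true  with σ (# 3) in σ₃
...     | true  = true-edge {a₁ = # 2} {a₂ = # 3} σ₂ σ₃ refl σ₀
...     | false = true-vertex-false-non-edge {a = # 2} {b₁ = # 0} {b₂ = # 3} σ₂ σ₀ σ₃ (λ ()) (λ ())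

-- Two polar partitions of C₅: A = {0,1,2} with parts {0,2}, {1} and B = {3,4};
-- A = {0,2} and B = {1} ∪ {3,4}.
side₁ side₂ : Fin 5 → Bool
side₁ i = toℕ i ℕ.<ᵇ 3
side₂ i = (toℕ i ℕ.≡ᵇ 0) ∨ (toℕ i ℕ.≡ᵇ 2)

part₁ clique₂ : Fin 5 → ℕ
part₁ i = if toℕ i ℕ.≡ᵇ 1 then 1 else 0
clique₂ i = if toℕ i ℕ.≡ᵇ 1 then 0 else 1

C₅-layout₁-A : ∀ i j → side₁ i ≡ true → side₁ j ≡ true → i ≢ j →
  E C5 i j ≡ not (does (part₁ i ℕ.≟ part₁ j))
C₅-layout₁-A = from-yes (all? λ i → all? λ j →
  (side₁ i ≟ᵇ true) →-dec (side₁ j ≟ᵇ true) →-dec ¬? (i ≟ᶠ j) →-dec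
  (E C5 i j ≟ᵇ not (does (part₁ i ℕ.≟ part₁ j))))

C₅-layout₁-B : ∀ i j → side₁ i ≡ false → side₁ j ≡ false → i ≢ j → E C5 i j ≡ true
C₅-layout₁-B = from-yes (all? λ i → all? λ j →
  (side₁ i ≟ᵇ false) →-dec (side₁ j ≟ᵇ false) →-dec ¬? (i ≟ᶠ j) →-dec (E C5 i j ≟ᵇ true))

C₅-layout₂-A : ∀ i j → side₂ i ≡ true → side₂ j ≡ true → E C5 i j ≡ false
C₅-layout₂-A = from-yes (all? λ i → all? λ j →
  (side₂ i ≟ᵇ true) →-dec (side₂ j ≟ᵇ true) →-dec (E C5 i j ≟ᵇ false))

C₅-layout₂-B : ∀ i j → side₂ i ≡ false → side₂ j ≡ false → i ≢ j →
  E C5 i j ≡ does (clique₂ i ℕ.≟ clique₂ j)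
C₅-layout₂-B = from-yes (all? λ i → all? λ j →
  (side₂ i ≟ᵇ false) →-dec (side₂ j ≟ᵇ false) →-dec ¬? (i ≟ᶠ j) →-dec
  (E C5 i j ≟ᵇ does (clique₂ i ℕ.≟ clique₂ j)))

part₁<2 : ∀ i → part₁ i < 2
part₁<2 = from-yes (all? λ i → part₁ i ℕ.<? 2)

clique₂<2 : ∀ i → clique₂ i < 2
clique₂<2 = from-yes (all? λ i → clique₂ i ℕ.<? 2)

C₅-neighbourhood-independent : ∀ j i i′ → Adj C5 j i → Adj C5 j i′ → E C5 i i′ ≡ false
C₅-neighbourhood-independent = from-yes (all? λ j → all? λ i → all? λ i′ →
  (E C5 j i ≟ᵇ true) →-dec (E C5 j i′ ≟ᵇ true) →-dec (E C5 i i′ ≟ᵇ false))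

C₅-non-neighbourhood-clique : ∀ j i i′ → j ≢ i → j ≢ i′ → i ≢ i′ →
  E C5 j i ≡ false → E C5 j i′ ≡ false → Adj C5 i i′
C₅-non-neighbourhood-clique = from-yes (all? λ j → all? λ i → all? λ i′ →
  ¬? (j ≟ᶠ i) →-dec ¬? (j ≟ᶠ i′) →-dec ¬? (i ≟ᶠ i′) →-dec
  (E C5 j i ≟ᵇ false) →-dec (E C5 j i′ ≟ᵇ false) →-dec (E C5 i i′ ≟ᵇ true))

-- Pseudo-split graphs whose S-part is a five-cycle

isC isS isI : Part → Bool
isC C = true
isC _ = false
isS S = true
isS _ = false
isI I = true
isI _ = false

byPart : {A : Set} → A → A → A → Part → A
byPart c s i C = c
byPart c s i S = s
byPart c s i I = i

module PseudoSplitWithC₅ {n : ℕ} (G : Graph n) (p : Fin n → Part)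
  (C-clique : ∀ u v → p u ≡ C → p v ≡ C → u ≢ v → Adj G u v)
  (I-independent : ∀ u v → p u ≡ I → p v ≡ I → ¬ Adj G u v)
  (g : Fin 5 → Fin n) (g-injective : Injective _≡_ _≡_ g)
  (g-S : ∀ i → p (g i) ≡ S) (g-onto : ∀ v → p v ≡ S → ∃ λ i → g i ≡ v)
  (g-iso : ∀ i j → E G (g i) (g j) ≡ E C5 i j)
  (C-S-complete : ∀ u v → p u ≡ C → p v ≡ S → Adj G u v)
  (I-S-anticomplete : ∀ u v → p u ≡ I → p v ≡ S → ¬ Adj G u v) where

  private
    index-at : ∀ x q → p x ≡ q → Fin 5
    index-at x S px = proj₁ (g-onto x px)
    index-at x _ _  = # 0

    g-index-at : ∀ x q (px : p x ≡ q) → q ≡ S → g (index-at x q px) ≡ x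
    g-index-at x S px _ = proj₂ (g-onto x px)

  -- index x is junk unless p x ≡ S; opaque, so that with-abstraction over p x
  -- does not reach inside (the same goes for C∩, I∩, C⁺, I⁻ below).
  opaque
    index : Fin n → Fin 5
    index x = index-at x (p x) refl

    g-index : ∀ {x} → p x ≡ S → g (index x) ≡ x
    g-index {x} = g-index-at x (p x) refl

  index-injective : ∀ {x y} → p x ≡ S → p y ≡ S → index x ≡ index y → x ≡ y
  index-injective px py e = trans (sym (g-index px)) (trans (cong g e) (g-index py))

  other-part : ∀ {u q r} → p u ≡ q → q ≢ r → p u ≢ r
  other-part pu q≢r pu≡r = q≢r (trans (sym pu) pu≡r)

  different-parts : ∀ {u v q r} → p u ≡ q → p v ≡ r → q ≢ r → u ≢ v
  different-parts pu pv q≢r refl = q≢r (trans (sym pu) pv)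

  E-S-S : ∀ {u v} → p u ≡ S → p v ≡ S → E G u v ≡ E C5 (index u) (index v)
  E-S-S pu pv = subst₂ (λ x y → E G x y ≡ E C5 (index _) (index _)) (g-index pu) (g-index pv) (g-iso _ _)

  E-I-I : ∀ {u v} → p u ≡ I → p v ≡ I → E G u v ≡ false
  E-I-I pu pv = ¬Adj⇒E≡false G (I-independent _ _ pu pv)

  E-I-S : ∀ {u v} → p u ≡ I → p v ≡ S → E G u v ≡ false
  E-I-S pu pv = ¬Adj⇒E≡false G (I-S-anticomplete _ _ pu pv)

  E-S-I : ∀ {u v} → p u ≡ S → p v ≡ I → E G u v ≡ false
  E-S-I pu pv = trans (E-sym G _ _) (E-I-S pv pu)

  E-S-C : ∀ {u v} → p u ≡ S → p v ≡ C → E G u v ≡ true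
  E-S-C pu pv = Adj-sym G (C-S-complete _ _ pv pu)

  opaque
    C∩ I∩ C⁺ I⁻ : (Fin n → Bool) → Fin n → Bool
    C∩ X x = isC (p x) ∧ X x
    I∩ X x = isI (p x) ∧ X x
    C⁺ X x = C∩ X x ∧ anyᵇ (λ u → I∩ X u ∧ E G x u)
    I⁻ X x = I∩ X x ∧ anyᵇ (λ w → C∩ X w ∧ not (E G x w))

  Type₁ Type₂ : ℕ → ℕ → (Fin n → Bool) → Set
  Type₁ s k X = count (I∩ X) < k × suc (count (C⁺ X)) < s
  Type₂ s k X = count (C∩ X) < s × suc (count (I⁻ X)) < k

  module Members (X : Fin n → Bool) where
    opaque
      unfolding C∩ I∩ C⁺ I⁻

      ∈C∩⁻ : ∀ {x} → C∩ X x ≡ true → p x ≡ C × X x ≡ true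
      ∈C∩⁻ {x} h with p x | h
      ... | C | Xx = refl , Xx

      ∈I∩⁻ : ∀ {x} → I∩ X x ≡ true → p x ≡ I × X x ≡ true
      ∈I∩⁻ {x} h with p x | h
      ... | I | Xx = refl , Xx

      ∈C∩⁺ : ∀ {x} → p x ≡ C → X x ≡ true → C∩ X x ≡ true
      ∈C∩⁺ px Xx rewrite px = Xx

      ∈I∩⁺ : ∀ {x} → p x ≡ I → X x ≡ true → I∩ X x ≡ true
      ∈I∩⁺ px Xx rewrite px = Xx

      ∉C∩ : ∀ {x} → p x ≢ C → C∩ X x ≡ false
      ∉C∩ {x} px≢C with p x
      ... | C = ⊥-elim (px≢C refl)
      ... | S = refl
      ... | I = refl

      ∉I∩ : ∀ {x} → p x ≢ I → I∩ X x ≡ false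
      ∉I∩ {x} px≢I with p x
      ... | I = ⊥-elim (px≢I refl)
      ... | C = refl
      ... | S = refl

      ∉C⁺ : ∀ {x} → p x ≢ C → C⁺ X x ≡ false
      ∉C⁺ px≢C rewrite ∉C∩ px≢C = refl

      ∉I⁻ : ∀ {x} → p x ≢ I → I⁻ X x ≡ false
      ∉I⁻ px≢I rewrite ∉I∩ px≢I = refl

      ∈C⁺⁻ : ∀ {x} → C⁺ X x ≡ true → C∩ X x ≡ true × ∃ λ u → I∩ X u ≡ true × Adj G x u
      ∈C⁺⁻ h with C∩X , any ← ∧-true⁻ h with u , Iu∧xu ← anyᵇ-elim _ any = C∩X , u , ∧-true⁻ Iu∧xu

      ∈I⁻⁻ : ∀ {x} → I⁻ X x ≡ true → I∩ X x ≡ true × ∃ λ w → C∩ X w ≡ true × ¬ Adj G x w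
      ∈I⁻⁻ h with I∩X , any ← ∧-true⁻ h with w , Cw∧¬xw ← anyᵇ-elim _ any
        with Cw , ¬xw ← ∧-true⁻ Cw∧¬xw = I∩X , w , Cw , E≡false⇒¬Adj G (not-true ¬xw)

      ∈C⁺⁺ : ∀ {x u} → C∩ X x ≡ true → I∩ X u ≡ true → Adj G x u → C⁺ X x ≡ true
      ∈C⁺⁺ {x} {u} Cx Iu xu = ∧-true⁺ Cx (anyᵇ-intro _ u (∧-true⁺ Iu xu))

      ∈I⁻⁺ : ∀ {x w} → I∩ X x ≡ true → C∩ X w ≡ true → ¬ Adj G x w → I⁻ X x ≡ true
      ∈I⁻⁺ {x} {w} Ix Cw ¬xw = ∧-true⁺ Ix (anyᵇ-intro _ w (∧-true⁺ Cw (cong not (¬Adj⇒E≡false G ¬xw))))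

      C⁺⊆C∩ : C⁺ X ⊆ C∩ X
      C⁺⊆C∩ _ x∈ = proj₁ (∈C⁺⁻ x∈)

      I⁻⊆I∩ : I⁻ X ⊆ I∩ X
      I⁻⊆I∩ _ x∈ = proj₁ (∈I⁻⁻ x∈)

      ∉C⁺⇒no-I-neighbour : ∀ {x u} → C∩ X x ≡ true → C⁺ X x ≡ false → I∩ X u ≡ true → ¬ Adj G x u
      ∉C⁺⇒no-I-neighbour Cx x∉ Iu xu with () ← trans (sym (∈C⁺⁺ Cx Iu xu)) x∉

      ∉I⁻⇒C-complete : ∀ {x w} → I∩ X x ≡ true → I⁻ X x ≡ false → C∩ X w ≡ true → Adj G x w
      ∉I⁻⇒C-complete {x} {w} Ix x∉ Cw with E G x w in xw
      ... | true  = refl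
      ... | false with () ← trans (sym (∈I⁻⁺ Ix Cw (E≡false⇒¬Adj G xw))) x∉

  g-distinct : ∀ {i j} → i ≢ j → g i ≢ g j
  g-distinct i≢j = i≢j ∘ g-injective

  module _ {s k : ℕ} {X : Fin n → Bool} (S⊆X : ∀ i → X (g i) ≡ true) (P : PolarOn s k G X) where
    open PolarPartition {s} {k} {n} {G} {X} P
    open Members X

    private
      σ : Fin 5 → Bool
      σ = side ∘ g

      S-on-A : ∀ {i} → σ i ≡ true → InA (g i)
      S-on-A σi = S⊆X _ , σi

      S-on-B : ∀ {i} → σ i ≡ false → InB (g i)
      S-on-B σi = S⊆X _ , σi

      on-A-or-B : ∀ {x} → X x ≡ true → InA x ⊎ InB x
      on-A-or-B {x} Xx with side x
      ... | true  = inj₁ (Xx , refl)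
      ... | false = inj₂ (Xx , refl)

    type-from-true-edge : ∀ {a₁ a₂ b} → σ a₁ ≡ true → σ a₂ ≡ true → Adj C5 a₁ a₂ → σ b ≡ false → Type₁ s k X
    type-from-true-edge {a₁} {a₂} {b} σa₁ σa₂ a₁a₂ σb =
      subst (_≤ k) count-I′ (B-independent-bound I′-on-B I′-independent) ,
      subst (_≤ s) count-C′ (A-clique-bound C′-on-A C′-clique)
      where
      A₁A₂ : Adj G (g a₁) (g a₂)
      A₁A₂ = trans (g-iso a₁ a₂) a₁a₂

      I-on-B : ∀ {u} → I∩ X u ≡ true → InB u
      I-on-B {u} Iu with pu , Xu ← ∈I∩⁻ Iu with on-A-or-B Xu
      ... | inj₂ Bu = Bu
      ... | inj₁ Au = ⊥-elim (A-nonadjacency-transitive (S-on-A σa₁) (S-on-A σa₂) Au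
                                (I-S-anticomplete _ _ pu (g-S a₁)) (I-S-anticomplete _ _ pu (g-S a₂)) A₁A₂)

      C⁺⇒C : ∀ {x} → C⁺ X x ≡ true → p x ≡ C
      C⁺⇒C Cx = proj₁ (∈C∩⁻ (proj₁ (∈C⁺⁻ Cx)))

      C⁺-on-A : ∀ {x} → C⁺ X x ≡ true → InA x
      C⁺-on-A {x} Cx with (Cx′ , u , Iu , xu) ← ∈C⁺⁻ Cx with on-A-or-B (proj₂ (∈C∩⁻ Cx′))
      ... | inj₁ Ax = Ax
      ... | inj₂ Bx = ⊥-elim (I-S-anticomplete _ _ pu (g-S b)
                        (B-adjacency-transitive (I-on-B Iu) (S-on-B σb) Bx xu (C-S-complete _ _ (C⁺⇒C Cx) (g-S b))
                          (different-parts pu (g-S b) λ ())))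
        where pu = proj₁ (∈I∩⁻ Iu)

      I′ C′ : Fin n → Bool
      I′ = insert (g b) (I∩ X)
      C′ = insert (g a₂) (insert (g a₁) (C⁺ X))

      I′-on-B : ∀ {x} → I′ x ≡ true → InB x
      I′-on-B = insert-all InB (S-on-B σb) I-on-B

      I′-independent : Independent G I′
      I′-independent = independent-insert G {I∩ X} {g b}
        (λ Ix Iy → I-independent _ _ (proj₁ (∈I∩⁻ Ix)) (proj₁ (∈I∩⁻ Iy)))
        (λ Ix bx → I-S-anticomplete _ _ (proj₁ (∈I∩⁻ Ix)) (g-S b) (Adj-sym G bx))

      count-I′ : count I′ ≡ suc (count (I∩ X))
      count-I′ = count-insert (I∩ X) (g b) (∉I∩ (other-part (g-S b) λ ()))

      C′-on-A : ∀ {x} → C′ x ≡ true → InA x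
      C′-on-A = insert-all InA (S-on-A σa₂) (insert-all InA (S-on-A σa₁) C⁺-on-A)

      C′-clique : Clique G C′
      C′-clique = clique-insert G {insert (g a₁) (C⁺ X)} {g a₂}
        (clique-insert G {C⁺ X} {g a₁} (λ Cx Cy → C-clique _ _ (C⁺⇒C Cx) (C⁺⇒C Cy))
          (λ Cx _ → E-S-C (g-S a₁) (C⁺⇒C Cx)))
        (λ {x} → insert-all (λ x → x ≢ g a₂ → Adj G (g a₂) x) (λ _ → Adj-sym G A₁A₂)
                   (λ Cx _ → E-S-C (g-S a₂) (C⁺⇒C Cx)))

      count-C′ : count C′ ≡ suc (suc (count (C⁺ X)))
      count-C′ = trans
        (count-insert _ (g a₂) (∉-insert {P = C⁺ X} (g-distinct (Adj⇒≢ C5 a₁a₂)) (∉C⁺ (other-part (g-S a₂) λ ()))))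
        (cong suc (count-insert _ (g a₁) (∉C⁺ (other-part (g-S a₁) λ ()))))

    type-from-false-non-edge : ∀ {a b₁ b₂} → σ a ≡ true → σ b₁ ≡ false → σ b₂ ≡ false →
      b₁ ≢ b₂ → ¬ Adj C5 b₁ b₂ → Type₂ s k X
    type-from-false-non-edge {a} {b₁} {b₂} σa σb₁ σb₂ b₁≢b₂ ¬b₁b₂ =
      subst (_≤ s) count-C′ (A-clique-bound C′-on-A C′-clique) ,
      subst (_≤ k) count-I′ (B-independent-bound I′-on-B I′-independent)
      where
      ¬B₁B₂ : ¬ Adj G (g b₁) (g b₂)
      ¬B₁B₂ = ¬b₁b₂ ∘ trans (sym (g-iso b₁ b₂))

      C-on-A : ∀ {x} → C∩ X x ≡ true → InA x
      C-on-A {x} Cx with px , Xx ← ∈C∩⁻ Cx with on-A-or-B Xx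
      ... | inj₁ Ax = Ax
      ... | inj₂ Bx = ⊥-elim (¬B₁B₂ (B-adjacency-transitive (S-on-B σb₁) (S-on-B σb₂) Bx
                                (C-S-complete _ _ px (g-S b₁)) (C-S-complete _ _ px (g-S b₂)) (g-distinct b₁≢b₂)))

      I⁻⇒I : ∀ {x} → I⁻ X x ≡ true → p x ≡ I
      I⁻⇒I Ix = proj₁ (∈I∩⁻ (proj₁ (∈I⁻⁻ Ix)))

      I⁻-on-B : ∀ {x} → I⁻ X x ≡ true → InB x
      I⁻-on-B {x} Ix with (Ix′ , w , Cw , ¬xw) ← ∈I⁻⁻ Ix with on-A-or-B (proj₂ (∈I∩⁻ Ix′))
      ... | inj₂ Bx = Bx
      ... | inj₁ Ax = ⊥-elim (A-nonadjacency-transitive (C-on-A Cw) (S-on-A σa) Ax ¬xw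
                                (I-S-anticomplete _ _ (I⁻⇒I Ix) (g-S a)) (C-S-complete _ _ (proj₁ (∈C∩⁻ Cw)) (g-S a)))

      C′ I′ : Fin n → Bool
      C′ = insert (g a) (C∩ X)
      I′ = insert (g b₂) (insert (g b₁) (I⁻ X))

      C′-on-A : ∀ {x} → C′ x ≡ true → InA x
      C′-on-A = insert-all InA (S-on-A σa) C-on-A

      C′-clique : Clique G C′
      C′-clique = clique-insert G {C∩ X} {g a}
        (λ Cx Cy → C-clique _ _ (proj₁ (∈C∩⁻ Cx)) (proj₁ (∈C∩⁻ Cy)))
        (λ Cx _ → E-S-C (g-S a) (proj₁ (∈C∩⁻ Cx)))

      count-C′ : count C′ ≡ suc (count (C∩ X))
      count-C′ = count-insert (C∩ X) (g a) (∉C∩ (other-part (g-S a) λ ()))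

      I′-on-B : ∀ {x} → I′ x ≡ true → InB x
      I′-on-B = insert-all InB (S-on-B σb₂) (insert-all InB (S-on-B σb₁) I⁻-on-B)

      I′-independent : Independent G I′
      I′-independent = independent-insert G {insert (g b₁) (I⁻ X)} {g b₂}
        (independent-insert G {I⁻ X} {g b₁} (λ Ix Iy → I-independent _ _ (I⁻⇒I Ix) (I⁻⇒I Iy))
          (λ Ix b₁x → I-S-anticomplete _ _ (I⁻⇒I Ix) (g-S b₁) (Adj-sym G b₁x)))
        (λ {x} → insert-all (λ x → ¬ Adj G (g b₂) x) (¬B₁B₂ ∘ Adj-sym G)
                   (λ Ix b₂x → I-S-anticomplete _ _ (I⁻⇒I Ix) (g-S b₂) (Adj-sym G b₂x)))

      count-I′ : count I′ ≡ suc (suc (count (I⁻ X)))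
      count-I′ = trans
        (count-insert _ (g b₂) (∉-insert {P = I⁻ X} (g-distinct b₁≢b₂) (∉I⁻ (other-part (g-S b₂) λ ()))))
        (cong suc (count-insert _ (g b₁) (∉I⁻ (other-part (g-S b₁) λ ()))))

    polarOn⇒type : Type₁ s k X ⊎ Type₂ s k X
    polarOn⇒type with C₅-colouring σ
    ... | true-edge σa₁ σa₂ a₁a₂ σb = inj₁ (type-from-true-edge σa₁ σa₂ a₁a₂ σb)
    ... | true-vertex-false-non-edge σa σb₁ σb₂ b₁≢b₂ ¬b₁b₂ =
      inj₂ (type-from-false-non-edge σa σb₁ σb₂ b₁≢b₂ ¬b₁b₂)
    ... | true-co-P₃ σ₀ σ₁ σ₃ =
      ⊥-elim (A-nonadjacency-transitive (S-on-A σ₀) (S-on-A σ₁) (S-on-A σ₃)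
                (E≡false⇒¬Adj G (g-iso _ _)) (E≡false⇒¬Adj G (g-iso _ _)) (g-iso _ _))
    ... | false-P₃ σ₀ σ₁ σ₂ =
      ⊥-elim (E≡false⇒¬Adj G (g-iso (# 0) (# 2))
                (B-adjacency-transitive (S-on-B σ₀) (S-on-B σ₂) (S-on-B σ₁) (g-iso _ _) (g-iso _ _)
                  (g-distinct (λ ()))))

  module _ {s k : ℕ} (X : Fin n → Bool) where
    open Members X

    type₁⇒polarOn : Type₁ s k X → PolarOn s k G X
    type₁⇒polarOn (I<k , C⁺+1<s) =
      polarOn-by-labels ⦃ >-nonZero (≤-trans (s≤s z≤n) C⁺+1<s) ⦄ ⦃ >-nonZero (≤-trans (s≤s z≤n) I<k) ⦄
        G X side α β α<s β<k E-on-A E-on-B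
      where
      side : Fin n → Bool
      side x = byPart (C⁺ X x) (side₁ (index x)) false (p x)

      α β : Fin n → ℕ
      α x = byPart (2 + rank (C⁺ X) x) (part₁ (index x)) 0 (p x)
      β x = byPart 0 0 (suc (rank (I∩ X) x)) (p x)

      α<s : ∀ {u} → X u ≡ true → side u ≡ true → α u < s
      α<s {u} Xu su with p u
      ... | C = ≤-trans (s≤s (s≤s (rank<count (C⁺ X) su))) C⁺+1<s
      ... | S = ≤-trans (part₁<2 (index u)) (≤-trans (s≤s (s≤s z≤n)) C⁺+1<s)

      β<k : ∀ {u} → X u ≡ true → side u ≡ false → β u < k
      β<k {u} Xu su with p u in pu
      ... | C = ≤-trans (s≤s z≤n) I<k
      ... | S = ≤-trans (s≤s z≤n) I<k
      ... | I = ≤-trans (s≤s (rank<count (I∩ X) (∈I∩⁺ pu Xu))) I<k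

      E-on-A : ∀ {u v} → X u ≡ true → X v ≡ true → side u ≡ true → side v ≡ true → u ≢ v →
               E G u v ≡ not (does (α u ℕ.≟ α v))
      E-on-A {u} {v} Xu Xv su sv u≢v with p u in pu | p v in pv
      ... | C | C = trans (C-clique u v pu pv u≢v)
                      (sym (different-labels (u≢v ∘ rank-injective (C⁺ X) su sv ∘ +-cancelˡ-≡ 2 _ _)))
      ... | C | S = trans (C-S-complete u v pu pv)
                      (sym (different-labels (≢-sym (<2⇒≢2+ _ (part₁<2 (index v))))))
      ... | S | C = trans (E-S-C pu pv) (sym (different-labels (<2⇒≢2+ _ (part₁<2 (index u)))))
      ... | S | S = trans (E-S-S pu pv) (C₅-layout₁-A (index u) (index v) su sv (u≢v ∘ index-injective pu pv))

      E-on-B : ∀ {u v} → X u ≡ true → X v ≡ true → side u ≡ false → side v ≡ false → u ≢ v →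
               E G u v ≡ does (β u ℕ.≟ β v)
      E-on-B {u} {v} Xu Xv su sv u≢v with p u in pu | p v in pv
      ... | C | C = C-clique u v pu pv u≢v
      ... | C | S = C-S-complete u v pu pv
      ... | S | C = E-S-C pu pv
      ... | S | S = trans (E-S-S pu pv) (C₅-layout₁-B (index u) (index v) su sv (u≢v ∘ index-injective pu pv))
      ... | C | I = ¬Adj⇒E≡false G (∉C⁺⇒no-I-neighbour (∈C∩⁺ pu Xu) su (∈I∩⁺ pv Xv))
      ... | I | C = ¬Adj⇒E≡false G (∉C⁺⇒no-I-neighbour (∈C∩⁺ pv Xv) sv (∈I∩⁺ pu Xu) ∘ Adj-sym G)
      ... | S | I = E-S-I pu pv
      ... | I | S = E-I-S pu pv
      ... | I | I = trans (E-I-I pu pv)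
                      (sym (dec-false (_ ℕ.≟ _)
                        (u≢v ∘ rank-injective (I∩ X) (∈I∩⁺ pu Xu) (∈I∩⁺ pv Xv) ∘ +-cancelˡ-≡ 1 _ _)))

    type₂⇒polarOn : Type₂ s k X → PolarOn s k G X
    type₂⇒polarOn (C<s , I⁻+1<k) =
      polarOn-by-labels ⦃ >-nonZero (≤-trans (s≤s z≤n) C<s) ⦄ ⦃ >-nonZero (≤-trans (s≤s z≤n) I⁻+1<k) ⦄
        G X side α β α<s β<k E-on-A E-on-B
      where
      side : Fin n → Bool
      side x = byPart true (side₂ (index x)) (not (I⁻ X x)) (p x)

      α β : Fin n → ℕ
      α x = byPart (suc (rank (C∩ X) x)) 0 0 (p x)
      β x = byPart 0 (clique₂ (index x)) (2 + rank (I⁻ X) x) (p x)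

      α<s : ∀ {u} → X u ≡ true → side u ≡ true → α u < s
      α<s {u} Xu su with p u in pu
      ... | C = ≤-trans (s≤s (rank<count (C∩ X) (∈C∩⁺ pu Xu))) C<s
      ... | S = ≤-trans (s≤s z≤n) C<s
      ... | I = ≤-trans (s≤s z≤n) C<s

      β<k : ∀ {u} → X u ≡ true → side u ≡ false → β u < k
      β<k {u} Xu su with p u
      ... | S = ≤-trans (clique₂<2 (index u)) (≤-trans (s≤s (s≤s z≤n)) I⁻+1<k)
      ... | I = ≤-trans (s≤s (s≤s (rank<count (I⁻ X) (not-false su)))) I⁻+1<k

      E-on-A : ∀ {u v} → X u ≡ true → X v ≡ true → side u ≡ true → side v ≡ true → u ≢ v →
               E G u v ≡ not (does (α u ℕ.≟ α v))
      E-on-A {u} {v} Xu Xv su sv u≢v with p u in pu | p v in pv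
      ... | C | C = trans (C-clique u v pu pv u≢v)
                      (sym (different-labels
                        (u≢v ∘ rank-injective (C∩ X) (∈C∩⁺ pu Xu) (∈C∩⁺ pv Xv) ∘ +-cancelˡ-≡ 1 _ _)))
      ... | C | S = C-S-complete u v pu pv
      ... | S | C = E-S-C pu pv
      ... | C | I = Adj-sym G (∉I⁻⇒C-complete (∈I∩⁺ pv Xv) (not-true sv) (∈C∩⁺ pu Xu))
      ... | I | C = ∉I⁻⇒C-complete (∈I∩⁺ pu Xu) (not-true su) (∈C∩⁺ pv Xv)
      ... | S | S = trans (E-S-S pu pv) (C₅-layout₂-A (index u) (index v) su sv)
      ... | S | I = E-S-I pu pv
      ... | I | S = E-I-S pu pv
      ... | I | I = E-I-I pu pv

      E-on-B : ∀ {u v} → X u ≡ true → X v ≡ true → side u ≡ false → side v ≡ false → u ≢ v →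
               E G u v ≡ does (β u ℕ.≟ β v)
      E-on-B {u} {v} Xu Xv su sv u≢v with p u in pu | p v in pv
      ... | S | S = trans (E-S-S pu pv) (C₅-layout₂-B (index u) (index v) su sv (u≢v ∘ index-injective pu pv))
      ... | S | I = trans (E-S-I pu pv) (sym (dec-false (_ ℕ.≟ _) (<2⇒≢2+ _ (clique₂<2 (index u)))))
      ... | I | S = trans (E-I-S pu pv) (sym (dec-false (_ ℕ.≟ _) (≢-sym (<2⇒≢2+ _ (clique₂<2 (index v))))))
      ... | I | I = trans (E-I-I pu pv)
                      (sym (dec-false (_ ℕ.≟ _)
                        (u≢v ∘ rank-injective (I⁻ X) (not-false su) (not-false sv) ∘ +-cancelˡ-≡ 2 _ _)))

  delete-S⇒polarOn : ∀ {s k v} .{{_ : NonZero s}} .{{_ : NonZero k}} → p v ≡ S → PolarOn s k G (full - v)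
  delete-S⇒polarOn {s} {k} {v} pv =
    polarOn-by-labels G (full - v) side (λ _ → 0) (λ _ → 0) (λ _ _ → >-nonZero⁻¹ s) (λ _ _ → >-nonZero⁻¹ k)
      E-on-A E-on-B
    where
    side : Fin n → Bool
    side x = byPart false (E C5 (index v) (index x)) true (p x)

    index-≢ : ∀ {u} → (full - v) u ≡ true → p u ≡ S → index v ≢ index u
    index-≢ u∈ pu = proj₂ (∈-delete⁻ {P = full} u∈) ∘ sym ∘ index-injective pv pu

    E-on-A : ∀ {u w} → (full - v) u ≡ true → (full - v) w ≡ true → side u ≡ true → side w ≡ true →
             u ≢ w →
             E G u w ≡ false
    E-on-A {u} {w} _ _ su sw _ with p u in pu | p w in pw
    ... | I | I = E-I-I pu pw
    ... | I | S = E-I-S pu pw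
    ... | S | I = E-S-I pu pw
    ... | S | S = trans (E-S-S pu pw) (C₅-neighbourhood-independent (index v) (index u) (index w) su sw)

    E-on-B : ∀ {u w} → (full - v) u ≡ true → (full - v) w ≡ true → side u ≡ false → side w ≡ false →
             u ≢ w →
             E G u w ≡ true
    E-on-B {u} {w} u∈ w∈ su sw u≢w with p u in pu | p w in pw
    ... | C | C = C-clique u w pu pw u≢w
    ... | C | S = C-S-complete u w pu pw
    ... | S | C = E-S-C pu pw
    ... | S | S = trans (E-S-S pu pw)
                    (C₅-non-neighbourhood-clique (index v) (index u) (index w) (index-≢ u∈ pu) (index-≢ w∈ pw)
                      (u≢w ∘ index-injective pu pw) su sw)

  module _ (X : Fin n → Bool) (w : Fin n) where
    private
      module X = Members X
      module X-w = Members (X - w)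

    C∩-delete : (C∩ X - w) ⊆ C∩ (X - w)
    C∩-delete x x∈ with Cx , x≢w ← ∈-delete⁻ {P = C∩ X} {w} x∈ with px , Xx ← X.∈C∩⁻ Cx =
      X-w.∈C∩⁺ px (∈-delete⁺ {P = X} {w} Xx x≢w)

    I∩-delete : (I∩ X - w) ⊆ I∩ (X - w)
    I∩-delete x x∈ with Ix , x≢w ← ∈-delete⁻ {P = I∩ X} {w} x∈ with px , Xx ← X.∈I∩⁻ Ix =
      X-w.∈I∩⁺ px (∈-delete⁺ {P = X} {w} Xx x≢w)

    C⁺-delete : p w ≢ I → (C⁺ X - w) ⊆ C⁺ (X - w)
    C⁺-delete pw≢I x x∈ with Cx , x≢w ← ∈-delete⁻ {P = C⁺ X} {w} x∈ with Cx′ , u , Iu , xu ← X.∈C⁺⁻ Cx =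
      X-w.∈C⁺⁺ (C∩-delete x (∈-delete⁺ {P = C∩ X} {w} Cx′ x≢w))
               (I∩-delete u (∈-delete⁺ {P = I∩ X} {w} Iu (λ { refl → pw≢I (proj₁ (X.∈I∩⁻ Iu)) }))) xu

    I⁻-delete : p w ≢ C → (I⁻ X - w) ⊆ I⁻ (X - w)
    I⁻-delete pw≢C x x∈ with Ix , x≢w ← ∈-delete⁻ {P = I⁻ X} {w} x∈ with Ix′ , u , Cu , ¬xu ← X.∈I⁻⁻ Ix =
      X-w.∈I⁻⁺ (I∩-delete x (∈-delete⁺ {P = I∩ X} {w} Ix′ x≢w))
               (C∩-delete u (∈-delete⁺ {P = C∩ X} {w} Cu (λ { refl → pw≢C (proj₁ (X.∈C∩⁻ Cu)) }))) ¬xu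

    C∩-delete⁻ : C∩ (X - w) ⊆ (C∩ X - w)
    C∩-delete⁻ x x∈ with px , X-w∋x ← X-w.∈C∩⁻ x∈ with Xx , x≢w ← ∈-delete⁻ {P = X} {w} X-w∋x =
      ∈-delete⁺ {P = C∩ X} {w} (X.∈C∩⁺ px Xx) x≢w

    I∩-delete⁻ : I∩ (X - w) ⊆ (I∩ X - w)
    I∩-delete⁻ x x∈ with px , X-w∋x ← X-w.∈I∩⁻ x∈ with Xx , x≢w ← ∈-delete⁻ {P = X} {w} X-w∋x =
      ∈-delete⁺ {P = I∩ X} {w} (X.∈I∩⁺ px Xx) x≢w

  module MinimalObstructionBound {s k : ℕ} (3≤s : 3 ≤ s) (3≤k : 3 ≤ k)
    (¬polar : ¬ PolarOn s k G full) (polar-delete : ∀ v → PolarOn s k G (full - v)) where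

    private
      module V = Members full
      module V- (v : Fin n) = Members (full - v)

    c i m f : ℕ
    c = count (C∩ full)
    i = count (I∩ full)
    m = count (C⁺ full)
    f = count (I⁻ full)

    ¬type₁ : ¬ Type₁ s k full
    ¬type₁ = ¬polar ∘ type₁⇒polarOn full

    ¬type₂ : ¬ Type₂ s k full
    ¬type₂ = ¬polar ∘ type₂⇒polarOn full

    private
      in-full-∖ : ∀ {v x : Fin n} → x ≢ v → (full - v) x ≡ true
      in-full-∖ {v} = ∈-delete⁺ {P = full} {v} refl

    deletion-type : ∀ {v} → p v ≢ S → Type₁ s k (full - v) ⊎ Type₂ s k (full - v)
    deletion-type {v} pv≢S = polarOn⇒type (λ j → in-full-∖ {v} λ { refl → pv≢S (g-S j) }) (polar-delete v)

    private
      C-deletion-links : ∀ {w u v} → p w ≡ C → p u ≡ I → p v ≡ I → u ≢ v → I⁻ (full - w) u ≡ false →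
        C∩ (full - w) ⊆ C⁺ (full - v)
      C-deletion-links {w} {u} {v} pw pu pv u≢v u∉I⁻ x x∈ with px , _ ← V-.∈C∩⁻ w x∈ =
        V-.∈C⁺⁺ v (V-.∈C∩⁺ v px (in-full-∖ (different-parts px pv λ ()))) (V-.∈I∩⁺ v pu (in-full-∖ u≢v))
          (Adj-sym G (V-.∉I⁻⇒C-complete w (V-.∈I∩⁺ w pu (in-full-∖ (different-parts pu pw λ ()))) u∉I⁻ x∈))

    C-deletions-not-all-type₁ : s ≤ c → ¬ (∀ {w} → p w ≡ C → Type₁ s k (full - w))
    C-deletions-not-all-type₁ s≤c all₁
      with w₀ , Cw₀ ← count>0⇒member (C∩ full) (≤-trans (≤-trans (s≤s z≤n) 3≤s) s≤c) =
      <-irrefl refl (begin-strict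
        c                               ≤⟨ count-mono {P = C∩ full} (λ x Cx → C-in-C⁺ (proj₁ (V.∈C∩⁻ Cx))) ⟩
        m                               ≤⟨ count≤suc-count-⊇delete w₀ (C⁺-delete full w₀ (other-part pw₀ λ ())) ⟩
        suc (count (C⁺ (full - w₀)))    <⟨ proj₂ (all₁ pw₀) ⟩
        s                               ≤⟨ s≤c ⟩
        c                               ∎)
      where
      open ≤-Reasoning
      pw₀ : p w₀ ≡ C
      pw₀ = proj₁ (V.∈C∩⁻ Cw₀)
      i<k : i < k
      i<k = ≤-trans (s≤s (count≤count-⊇delete w₀ (V.∉I∩ (other-part pw₀ λ ())) (I∩-delete full w₀)))
                    (proj₁ (all₁ pw₀))
      C-in-C⁺ : ∀ {w} → p w ≡ C → C⁺ full w ≡ true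
      C-in-C⁺ {w} pw with C⁺ full w in w∈
      ... | true  = refl
      ... | false = ⊥-elim (¬type₁ (i<k , ≤-trans
              (s≤s (s≤s (count≤count-⊇delete w w∈ (C⁺-delete full w (other-part pw λ ()))))) (proj₂ (all₁ pw))))

    I-deletions-not-all-type₂ : k ≤ i → ¬ (∀ {v} → p v ≡ I → Type₂ s k (full - v))
    I-deletions-not-all-type₂ k≤i all₂
      with v₀ , Iv₀ ← count>0⇒member (I∩ full) (≤-trans (≤-trans (s≤s z≤n) 3≤k) k≤i) =
      <-irrefl refl (begin-strict
        i                               ≤⟨ count-mono {P = I∩ full} (λ x Ix → I-in-I⁻ (proj₁ (V.∈I∩⁻ Ix))) ⟩
        f                               ≤⟨ count≤suc-count-⊇delete v₀ (I⁻-delete full v₀ (other-part pv₀ λ ())) ⟩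
        suc (count (I⁻ (full - v₀)))    <⟨ proj₂ (all₂ pv₀) ⟩
        k                               ≤⟨ k≤i ⟩
        i                               ∎)
      where
      open ≤-Reasoning
      pv₀ : p v₀ ≡ I
      pv₀ = proj₁ (V.∈I∩⁻ Iv₀)
      c<s : c < s
      c<s = ≤-trans (s≤s (count≤count-⊇delete v₀ (V.∉C∩ (other-part pv₀ λ ())) (C∩-delete full v₀)))
                    (proj₁ (all₂ pv₀))
      I-in-I⁻ : ∀ {v} → p v ≡ I → I⁻ full v ≡ true
      I-in-I⁻ {v} pv with I⁻ full v in v∈
      ... | true  = refl
      ... | false = ⊥-elim (¬type₂ (c<s , ≤-trans
              (s≤s (s≤s (count≤count-⊇delete v v∈ (I⁻-delete full v (other-part pv λ ()))))) (proj₂ (all₂ pv))))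

    c≤s : c ≤ s
    c≤s with c ≤? s
    ... | yes c≤s = c≤s
    ... | no  c≰s = ⊥-elim (C-deletions-not-all-type₁ (<⇒≤ (≰⇒> c≰s)) all₁)
      where
      all₁ : ∀ {w} → p w ≡ C → Type₁ s k (full - w)
      all₁ {w} pw with deletion-type (other-part pw λ ())
      ... | inj₁ type₁ = type₁
      ... | inj₂ (c-w<s , _) = ⊥-elim (c≰s (≤-trans (count≤suc-count-⊇delete w (C∩-delete full w)) c-w<s))

    i≤k : i ≤ k
    i≤k with i ≤? k
    ... | yes i≤k = i≤k
    ... | no  i≰k = ⊥-elim (I-deletions-not-all-type₂ (<⇒≤ (≰⇒> i≰k)) all₂)
      where
      all₂ : ∀ {v} → p v ≡ I → Type₂ s k (full - v)
      all₂ {v} pv with deletion-type (other-part pv λ ())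
      ... | inj₂ type₂ = type₂
      ... | inj₁ (i-v<k , _) = ⊥-elim (i≰k (≤-trans (count≤suc-count-⊇delete v (I∩-delete full v)) i-v<k))

    ¬[s≤c×k≤1+i] : s ≤ c → k ≤ suc i → ⊥
    ¬[s≤c×k≤1+i] s≤c k≤1+i = C-deletions-not-all-type₁ s≤c all₁
      where
      open ≤-Reasoning
      2≤i : 2 ≤ i
      2≤i = ≤-pred (≤-trans 3≤k k≤1+i)

      I-in-I⁻ : ∀ {w u} → p w ≡ C → p u ≡ I → I⁻ (full - w) u ≡ true
      I-in-I⁻ {w} {u} pw pu with I⁻ (full - w) u in u∈
      ... | true  = refl
      ... | false with v , Iv , v≢u ← count≥2⇒other-member (I∩ full) 2≤i u
                  with deletion-type (other-part (proj₁ (V.∈I∩⁻ Iv)) λ ())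
      ...   | inj₂ (c-v<s , _) = ⊥-elim (<-irrefl refl (begin-strict
              c                            ≤⟨ count≤count-⊇delete v (V.∉C∩ (other-part pv λ ())) (C∩-delete full v) ⟩
              count (C∩ (full - v))        <⟨ c-v<s ⟩
              s                            ≤⟨ s≤c ⟩
              c                            ∎))
        where pv = proj₁ (V.∈I∩⁻ Iv)
      ...   | inj₁ (_ , m-v+1<s) = ⊥-elim (<-irrefl refl (begin-strict
              c                            ≤⟨ count≤suc-count-⊇delete w (C∩-delete full w) ⟩
              suc (count (C∩ (full - w)))  ≤⟨ s≤s (count-mono (C-deletion-links pw pu pv (≢-sym v≢u) u∈)) ⟩
              suc (count (C⁺ (full - v)))  <⟨ m-v+1<s ⟩
              s                            ≤⟨ s≤c ⟩
              c                            ∎))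
        where pv = proj₁ (V.∈I∩⁻ Iv)

      all₁ : ∀ {w} → p w ≡ C → Type₁ s k (full - w)
      all₁ {w} pw with deletion-type (other-part pw λ ())
      ... | inj₁ type₁ = type₁
      ... | inj₂ (_ , f-w+1<k) = ⊥-elim (<-irrefl refl (begin-strict
              suc (count (I⁻ (full - w)))  <⟨ f-w+1<k ⟩
              k                            ≤⟨ k≤1+i ⟩
              suc i                        ≤⟨ s≤s (count-mono {P = I∩ full} (λ u Iu → I-in-I⁻ pw (proj₁ (V.∈I∩⁻ Iu)))) ⟩
              suc (count (I⁻ (full - w)))  ∎))

    ¬[s≤1+c×k≤i] : s ≤ suc c → k ≤ i → ⊥
    ¬[s≤1+c×k≤i] s≤1+c k≤i = I-deletions-not-all-type₂ k≤i all₂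
      where
      open ≤-Reasoning
      2≤c : 2 ≤ c
      2≤c = ≤-pred (≤-trans 3≤s s≤1+c)

      unlinked-I-vertex : ∀ {w} → suc (count (I⁻ (full - w))) < k →
        ∀ v → ∃ λ u → p u ≡ I × I⁻ (full - w) u ≡ false × u ≢ v
      unlinked-I-vertex {w} f-w+1<k v =
        let u , Uu , u≢v = count≥2⇒other-member unlinked 2≤unlinked v
        in  u , proj₁ (V.∈I∩⁻ (proj₁ (∧-true⁻ Uu))) , not-true (proj₂ (∧-true⁻ Uu)) , u≢v
        where
        unlinked : Fin n → Bool
        unlinked u = I∩ full u ∧ not (I⁻ (full - w) u)
        split : ∀ {a} b → a ≡ true → b ∨ (a ∧ not b) ≡ true
        split true  _    = refl
        split false refl = refl
        2≤unlinked : 2 ≤ count unlinked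
        2≤unlinked = +-cancelˡ-≤ (count (I⁻ (full - w))) 2 _ (begin
          count (I⁻ (full - w)) + 2                   ≡⟨ +-comm _ 2 ⟩
          suc (suc (count (I⁻ (full - w))))           ≤⟨ f-w+1<k ⟩
          k                                           ≤⟨ k≤i ⟩
          i                                           ≤⟨ count-mono (λ u Iu → split (I⁻ (full - w) u) Iu) ⟩
          count (λ u → I⁻ (full - w) u ∨ unlinked u)  ≤⟨ count-∪ (I⁻ (full - w)) unlinked ⟩
          count (I⁻ (full - w)) + count unlinked      ∎)

      C-in-C⁺ : ∀ {v x} → p v ≡ I → p x ≡ C → C⁺ (full - v) x ≡ true
      C-in-C⁺ {v} {x} pv px with w , Cw , w≢x ← count≥2⇒other-member (C∩ full) 2≤c x
                          with deletion-type (other-part (proj₁ (V.∈C∩⁻ Cw)) λ ())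
      ... | inj₁ (i-w<k , _) = ⊥-elim (<-irrefl refl (begin-strict
              i                            ≤⟨ count≤count-⊇delete w (V.∉I∩ (other-part pw λ ())) (I∩-delete full w) ⟩
              count (I∩ (full - w))        <⟨ i-w<k ⟩
              k                            ≤⟨ k≤i ⟩
              i                            ∎))
        where pw = proj₁ (V.∈C∩⁻ Cw)
      ... | inj₂ (_ , f-w+1<k) with u , pu , u∉I⁻ , u≢v ← unlinked-I-vertex {w} f-w+1<k v =
        C-deletion-links (proj₁ (V.∈C∩⁻ Cw)) pu pv u≢v u∉I⁻ x (V-.∈C∩⁺ w px (in-full-∖ (≢-sym w≢x)))

      all₂ : ∀ {v} → p v ≡ I → Type₂ s k (full - v)
      all₂ {v} pv with deletion-type (other-part pv λ ())
      ... | inj₂ type₂ = type₂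
      ... | inj₁ (_ , m-v+1<s) = ⊥-elim (<-irrefl refl (begin-strict
              suc (count (C⁺ (full - v)))  <⟨ m-v+1<s ⟩
              s                            ≤⟨ s≤1+c ⟩
              suc c                        ≤⟨ s≤s (count-mono {P = C∩ full} (λ x Cx → C-in-C⁺ pv (proj₁ (V.∈C∩⁻ Cx)))) ⟩
              suc (count (C⁺ (full - v)))  ∎))

    c+i+2≤s+k : suc (suc (c + i)) ≤ s + k
    c+i+2≤s+k with s ≤? suc c
    ... | no  s≰1+c = +-mono-≤ (≰⇒> s≰1+c) i≤k
    ... | yes s≤1+c with s ≤? c
    ...   | yes s≤c = subst (_≤ s + k) (trans (+-suc c (suc i)) (cong suc (+-suc c i)))
                        (+-mono-≤ c≤s (≰⇒> (¬[s≤c×k≤1+i] s≤c)))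
    ...   | no  s≰c = subst (_≤ s + k) (cong suc (+-suc c i))
                        (+-mono-≤ (≰⇒> s≰c) (≰⇒> (¬[s≤1+c×k≤i] s≤1+c)))

    n≤5+c+i : n ≤ 5 + (c + i)
    n≤5+c+i = begin
      n                                                       ≡⟨ sym (count-full {n}) ⟩
      count (full {n})                                        ≤⟨ count-mono cover ⟩
      count (λ x → isS (p x) ∨ (C∩ full x ∨ I∩ full x))       ≤⟨ count-∪ (isS ∘ p) _ ⟩
      count (isS ∘ p) + count (λ x → C∩ full x ∨ I∩ full x)   ≤⟨ +-mono-≤ S≤5 (count-∪ (C∩ full) (I∩ full)) ⟩
      5 + (c + i)                                             ∎
      where
      open ≤-Reasoning
      cover : full {n} ⊆ (λ x → isS (p x) ∨ (C∩ full x ∨ I∩ full x))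
      cover x _ with p x in px
      ... | C rewrite V.∈C∩⁺ px refl = refl
      ... | S = refl
      ... | I rewrite V.∈I∩⁺ px refl = ∨-zeroʳ _
      isS⁻ : ∀ {q} → isS q ≡ true → q ≡ S
      isS⁻ {S} _ = refl
      S≤5 : count (isS ∘ p) ≤ 5
      S≤5 = count-injection (isS ∘ p) index (λ Sx Sy → index-injective (isS⁻ Sx) (isS⁻ Sy))

    vertex-bound : n ≤ s + k + 3
    vertex-bound = begin
      n                      ≤⟨ n≤5+c+i ⟩
      3 + suc (suc (c + i))  ≤⟨ +-monoʳ-≤ 3 c+i+2≤s+k ⟩
      3 + (s + k)            ≡⟨ +-comm 3 (s + k) ⟩
      s + k + 3              ∎
      where open ≤-Reasoning

split⇒polar : ∀ {s k n} .{{_ : NonZero s}} .{{_ : NonZero k}} (G : Graph n) (p : Fin n → Part) →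
  (∀ u v → p u ≡ C → p v ≡ C → u ≢ v → Adj G u v) → (∀ u v → p u ≡ I → p v ≡ I → ¬ Adj G u v) →
  (∀ v → p v ≢ S) → Polar s k G
split⇒polar {s} {k} G p C-clique I-independent no-S = polarOn-full⇒polar G
  (polarOn-by-labels G full side (λ _ → 0) (λ _ → 0) (λ _ _ → >-nonZero⁻¹ s) (λ _ _ → >-nonZero⁻¹ k)
     E-on-A E-on-B)
  where
  side : Fin _ → Bool
  side x = isI (p x)

  E-on-A : ∀ {u v} → full u ≡ true → full v ≡ true → side u ≡ true → side v ≡ true → u ≢ v → E G u v ≡ false
  E-on-A {u} {v} _ _ su sv _ with p u in pu | p v in pv
  ... | I | I = ¬Adj⇒E≡false G (I-independent u v pu pv)
  ... | S | _ = ⊥-elim (no-S u pu)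
  ... | I | S = ⊥-elim (no-S v pv)

  E-on-B : ∀ {u v} → full u ≡ true → full v ≡ true → side u ≡ false → side v ≡ false → u ≢ v → E G u v ≡ true
  E-on-B {u} {v} _ _ su sv u≢v with p u in pu | p v in pv
  ... | C | C = C-clique u v pu pv u≢v
  ... | S | _ = ⊥-elim (no-S u pu)
  ... | C | S = ⊥-elim (no-S v pv)

3≤⇒nonZero : ∀ {m} → 3 ≤ m → NonZero m
3≤⇒nonZero 3≤m = >-nonZero (≤-trans (s≤s z≤n) 3≤m)

minimal-obstruction-bound : ∀ {s k} → 3 ≤ s → 3 ≤ k →
  ∀ {n} (G : Graph n) → PseudoSplit G → MinimalObstruction s k G → n ≤ s + k + 3
minimal-obstruction-bound _ _ {zero} _ _ _ = z≤n
minimal-obstruction-bound 3≤s 3≤k {suc n} G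
  (p , C-clique , I-independent , S-part , C-S , I-S) (¬polar , polar-delete) with S-part
... | inj₁ no-S =
  ⊥-elim (¬polar (split⇒polar ⦃ 3≤⇒nonZero 3≤s ⦄ ⦃ 3≤⇒nonZero 3≤k ⦄ G p C-clique I-independent no-S))
... | inj₂ (g , g-injective , g-S , g-onto , g-iso) =
  MinimalObstructionBound.vertex-bound 3≤s 3≤k (¬polar ∘ polarOn-full⇒polar G)
    (λ v → polar-delete⇒polarOn G v ⦃ 3≤⇒nonZero 3≤s ⦄ ⦃ 3≤⇒nonZero 3≤k ⦄ (polar-delete v))
  where open PseudoSplitWithC₅ G p C-clique I-independent g g-injective g-S g-onto g-iso C-S I-S

-- Tightness

pattern S-vertex j = inj₁ j
pattern C-vertex a = inj₂ (inj₁ a)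
pattern I-vertex b = inj₂ (inj₂ b)

-- Every vertex of C has a neighbour in I and
-- every vertex of I a non-neighbour in C, so the graph has neither type, while
-- deleting a vertex of C (of I) leaves type 1 (type 2).
module TightExample (c′ i′ : ℕ) where

  Kind : Set
  Kind = Fin 5 ⊎ (Fin (2 + c′) ⊎ Fin (2 + i′))

  N : ℕ
  N = 5 + ((2 + c′) + (2 + i′))

  opaque
    kind : Fin N → Kind
    kind x = map₂ (splitAt (2 + c′)) (splitAt 5 x)

    vertex : Kind → Fin N
    vertex κ = join 5 _ (map₂ (join (2 + c′) (2 + i′)) κ)

    kind-vertex : ∀ κ → kind (vertex κ) ≡ κ
    kind-vertex (S-vertex j) rewrite splitAt-↑ˡ 5 j ((2 + c′) + (2 + i′)) = refl
    kind-vertex (inj₂ κ′) rewrite splitAt-↑ʳ 5 ((2 + c′) + (2 + i′)) (join (2 + c′) (2 + i′) κ′) =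
      cong inj₂ (splitAt-join _ _ κ′)

    vertex-kind : ∀ x → vertex (kind x) ≡ x
    vertex-kind x =
      trans (cong (join 5 ((2 + c′) + (2 + i′))) (join-map₂-splitAt (splitAt 5 x))) (join-splitAt 5 _ x)
      where
      join-map₂-splitAt : ∀ (σ : Fin 5 ⊎ Fin ((2 + c′) + (2 + i′))) →
        map₂ (join (2 + c′) (2 + i′)) (map₂ (splitAt (2 + c′)) σ) ≡ σ
      join-map₂-splitAt (inj₁ j) = refl
      join-map₂-splitAt (inj₂ y) = cong inj₂ (join-splitAt (2 + c′) (2 + i′) y)

  kind-injective : ∀ {x y} → kind x ≡ kind y → x ≡ y
  kind-injective {x} {y} e = trans (sym (vertex-kind x)) (trans (cong vertex e) (vertex-kind y))

  part : Kind → Part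
  part (S-vertex _) = S
  part (C-vertex _) = C
  part (I-vertex _) = I

  linked : Fin (2 + c′) → Fin (2 + i′) → Bool
  linked zero    zero          = true
  linked (suc _) (suc zero)    = true
  linked _       _             = false

  partner : Fin (2 + c′) → Fin (2 + i′)
  partner zero    = zero
  partner (suc _) = suc zero

  linked-partner : ∀ a → linked a (partner a) ≡ true
  linked-partner zero    = refl
  linked-partner (suc _) = refl

  non-partner : Fin (2 + i′) → Fin (2 + c′)
  non-partner zero    = suc zero
  non-partner (suc _) = zero

  unlinked-non-partner : ∀ b → linked (non-partner b) b ≡ false
  unlinked-non-partner zero          = refl
  unlinked-non-partner (suc zero)    = refl
  unlinked-non-partner (suc (suc _)) = refl

  adjacency : Kind → Kind → Bool
  adjacency (S-vertex j) (S-vertex j′) = E C5 j j′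
  adjacency (S-vertex _) (C-vertex _)  = true
  adjacency (C-vertex _) (S-vertex _)  = true
  adjacency (C-vertex a) (C-vertex a′) = not (does (a ≟ᶠ a′))
  adjacency (C-vertex a) (I-vertex b)  = linked a b
  adjacency (I-vertex b) (C-vertex a)  = linked a b
  adjacency _            _             = false

  adjacency-sym : ∀ κ κ′ → adjacency κ κ′ ≡ adjacency κ′ κ
  adjacency-sym (S-vertex j) (S-vertex j′) = E-sym C5 j j′
  adjacency-sym (S-vertex _) (C-vertex _)  = refl
  adjacency-sym (S-vertex _) (I-vertex _)  = refl
  adjacency-sym (C-vertex _) (S-vertex _)  = refl
  adjacency-sym (C-vertex a) (C-vertex a′) = cong not (does-⇔ (mk⇔ sym sym) (a ≟ᶠ a′) (a′ ≟ᶠ a))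
  adjacency-sym (C-vertex _) (I-vertex _)  = refl
  adjacency-sym (I-vertex _) (S-vertex _)  = refl
  adjacency-sym (I-vertex _) (C-vertex _)  = refl
  adjacency-sym (I-vertex _) (I-vertex _)  = refl

  adjacency-irrefl : ∀ κ → adjacency κ κ ≡ false
  adjacency-irrefl (S-vertex j) = irrefl C5 j
  adjacency-irrefl (C-vertex a) = cong not (dec-true (a ≟ᶠ a) refl)
  adjacency-irrefl (I-vertex _) = refl

  G : Graph N
  G = record
    { E      = λ x y → adjacency (kind x) (kind y)
    ; sym    = λ x y → adjacency-sym (kind x) (kind y)
    ; irrefl = λ x → adjacency-irrefl (kind x)
    }

  p : Fin N → Part
  p x = part (kind x)

  g : Fin 5 → Fin N
  g j = vertex (S-vertex j)

  kind-of-S : ∀ {x} → p x ≡ S → ∃ λ j → kind x ≡ S-vertex j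
  kind-of-S {x} px with kind x | px
  ... | S-vertex j | _  = j , refl
  ... | C-vertex _ | ()
  ... | I-vertex _ | ()

  kind-of-C : ∀ {x} → p x ≡ C → ∃ λ a → kind x ≡ C-vertex a
  kind-of-C {x} px with kind x | px
  ... | C-vertex a | _ = a , refl

  kind-of-I : ∀ {x} → p x ≡ I → ∃ λ b → kind x ≡ I-vertex b
  kind-of-I {x} px with kind x | px
  ... | I-vertex b | _ = b , refl

  C-clique : ∀ u v → p u ≡ C → p v ≡ C → u ≢ v → Adj G u v
  C-clique u v pu pv u≢v with a , ku ← kind-of-C {u} pu | a′ , kv ← kind-of-C {v} pv rewrite ku | kv =
    cong not (dec-false (a ≟ᶠ a′) λ { refl → u≢v (kind-injective (trans ku (sym kv))) })

  I-independent : ∀ u v → p u ≡ I → p v ≡ I → ¬ Adj G u v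
  I-independent u v pu pv with _ , ku ← kind-of-I {u} pu | _ , kv ← kind-of-I {v} pv rewrite ku | kv = λ ()

  g-injective : Injective _≡_ _≡_ g
  g-injective e = inj₁-injective (trans (sym (kind-vertex _)) (trans (cong kind e) (kind-vertex _)))

  g-S : ∀ j → p (g j) ≡ S
  g-S j = cong part (kind-vertex (S-vertex j))

  g-onto : ∀ v → p v ≡ S → ∃ λ j → g j ≡ v
  g-onto v pv with j , kv ← kind-of-S {v} pv = j , trans (cong vertex (sym kv)) (vertex-kind v)

  g-iso : ∀ i j → E G (g i) (g j) ≡ E C5 i j
  g-iso i j = cong₂ adjacency (kind-vertex (S-vertex i)) (kind-vertex (S-vertex j))

  C-S-complete : ∀ u v → p u ≡ C → p v ≡ S → Adj G u v
  C-S-complete u v pu pv with _ , ku ← kind-of-C {u} pu | _ , kv ← kind-of-S {v} pv rewrite ku | kv = refl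

  I-S-anticomplete : ∀ u v → p u ≡ I → p v ≡ S → ¬ Adj G u v
  I-S-anticomplete u v pu pv with _ , ku ← kind-of-I {u} pu | _ , kv ← kind-of-S {v} pv rewrite ku | kv = λ ()

  pseudo-split : PseudoSplit G
  pseudo-split = p , C-clique , I-independent , inj₂ (g , g-injective , g-S , g-onto , g-iso) ,
                 C-S-complete , I-S-anticomplete

  open PseudoSplitWithC₅ G p C-clique I-independent g g-injective g-S g-onto g-iso C-S-complete I-S-anticomplete
  private
    module V = Members full

  C-vertex-member : ∀ a → C∩ full (vertex (C-vertex a)) ≡ true
  C-vertex-member a = V.∈C∩⁺ (cong part (kind-vertex (C-vertex a))) refl

  I-vertex-member : ∀ b → I∩ full (vertex (I-vertex b)) ≡ true
  I-vertex-member b = V.∈I∩⁺ (cong part (kind-vertex (I-vertex b))) refl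

  vertex-injective : Injective _≡_ _≡_ vertex
  vertex-injective e = trans (sym (kind-vertex _)) (trans (cong kind e) (kind-vertex _))

  2+c′≤|C| : 2 + c′ ≤ count (C∩ full)
  2+c′≤|C| = injection⇒≤count (C∩ full) (vertex ∘ C-vertex) (inj₁-injective ∘ inj₂-injective ∘ vertex-injective)
               C-vertex-member

  2+i′≤|I| : 2 + i′ ≤ count (I∩ full)
  2+i′≤|I| = injection⇒≤count (I∩ full) (vertex ∘ I-vertex) (inj₂-injective ∘ inj₂-injective ∘ vertex-injective)
               I-vertex-member

  |C|≤2+c′ : count (C∩ full) ≤ 2 + c′
  |C|≤2+c′ = count-injection (C∩ full) (C-index ∘ kind) C-index-injective
    where
    C-index : Kind → Fin (2 + c′)
    C-index (C-vertex a) = a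
    C-index _            = zero
    C-index-injective : ∀ {x y} → C∩ full x ≡ true → C∩ full y ≡ true → C-index (kind x) ≡ C-index (kind y) → x ≡ y
    C-index-injective {x} {y} Cx Cy e
      with _ , kx ← kind-of-C {x} (proj₁ (V.∈C∩⁻ Cx)) | _ , ky ← kind-of-C {y} (proj₁ (V.∈C∩⁻ Cy))
      rewrite kx | ky = kind-injective (trans kx (trans (cong C-vertex e) (sym ky)))

  |I|≤2+i′ : count (I∩ full) ≤ 2 + i′
  |I|≤2+i′ = count-injection (I∩ full) (I-index ∘ kind) I-index-injective
    where
    I-index : Kind → Fin (2 + i′)
    I-index (I-vertex b) = b
    I-index _            = zero
    I-index-injective : ∀ {x y} → I∩ full x ≡ true → I∩ full y ≡ true → I-index (kind x) ≡ I-index (kind y) → x ≡ y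
    I-index-injective {x} {y} Ix Iy e
      with _ , kx ← kind-of-I {x} (proj₁ (V.∈I∩⁻ Ix)) | _ , ky ← kind-of-I {y} (proj₁ (V.∈I∩⁻ Iy))
      rewrite kx | ky = kind-injective (trans kx (trans (cong I-vertex e) (sym ky)))

  C⊆C⁺ : C∩ full ⊆ C⁺ full
  C⊆C⁺ x Cx with a , kx ← kind-of-C {x} (proj₁ (V.∈C∩⁻ Cx)) =
    V.∈C⁺⁺ Cx (I-vertex-member (partner a))
      (trans (cong₂ adjacency kx (kind-vertex (I-vertex (partner a)))) (linked-partner a))

  I⊆I⁻ : I∩ full ⊆ I⁻ full
  I⊆I⁻ y Iy with b , ky ← kind-of-I {y} (proj₁ (V.∈I∩⁻ Iy)) =
    V.∈I⁻⁺ Iy (C-vertex-member (non-partner b))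
      (E≡false⇒¬Adj G (trans (cong₂ adjacency ky (kind-vertex (C-vertex (non-partner b)))) (unlinked-non-partner b)))

  not-polar : ¬ Polar (3 + c′) (3 + i′) G
  not-polar P with polarOn⇒type (λ _ → refl) (polar⇒polarOn-full G P)
  ... | inj₁ (_ , C⁺+1<s) = <-irrefl refl (begin-strict
          2 + c′             ≤⟨ 2+c′≤|C| ⟩
          count (C∩ full)    ≤⟨ count-mono C⊆C⁺ ⟩
          count (C⁺ full)    <⟨ ≤-pred C⁺+1<s ⟩
          2 + c′             ∎)
    where open ≤-Reasoning
  ... | inj₂ (_ , I⁻+1<k) = <-irrefl refl (begin-strict
          2 + i′             ≤⟨ 2+i′≤|I| ⟩
          count (I∩ full)    ≤⟨ count-mono I⊆I⁻ ⟩
          count (I⁻ full)    <⟨ ≤-pred I⁻+1<k ⟩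
          2 + i′             ∎)
    where open ≤-Reasoning

  polar-deletions : ∀ v → Polar (3 + c′) (3 + i′) (delete G v)
  polar-deletions v with p v in pv
  ... | S = polarOn-delete⇒polar G v (delete-S⇒polarOn pv)
  ... | C = polarOn-delete⇒polar G v (type₁⇒polarOn (full - v) (I-v<k , C⁺-v+1<s))
    where
    I-v<k : count (I∩ (full - v)) < 3 + i′
    I-v<k = s≤s (≤-trans (count-mono (⊆-trans (I∩-delete⁻ full v) (delete-⊆ {P = I∩ full} {v}))) |I|≤2+i′)
    C⁺-v+1<s : suc (count (C⁺ (full - v))) < 3 + c′
    C⁺-v+1<s = s≤s (≤-trans
      (count-⊂ v (⊆-trans (Members.C⁺⊆C∩ (full - v)) (C∩-delete⁻ full v)) (V.∈C∩⁺ pv refl)) |C|≤2+c′)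
  ... | I = polarOn-delete⇒polar G v (type₂⇒polarOn (full - v) (C-v<s , I⁻-v+1<k))
    where
    C-v<s : count (C∩ (full - v)) < 3 + c′
    C-v<s = s≤s (≤-trans (count-mono (⊆-trans (C∩-delete⁻ full v) (delete-⊆ {P = C∩ full} {v}))) |C|≤2+c′)
    I⁻-v+1<k : suc (count (I⁻ (full - v))) < 3 + i′
    I⁻-v+1<k = s≤s (≤-trans
      (count-⊂ v (⊆-trans (Members.I⁻⊆I∩ (full - v)) (I∩-delete⁻ full v)) (V.∈I∩⁺ pv refl)) |I|≤2+i′)

  minimal-obstruction : MinimalObstruction (3 + c′) (3 + i′) G
  minimal-obstruction = not-polar , polar-deletions

tight-example : ∀ {s k} → 3 ≤ s → 3 ≤ k → Σ (Graph (s + k + 3)) (λ G → PseudoSplit G × MinimalObstruction s k G)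
tight-example {suc (suc (suc c′))} {suc (suc (suc i′))} (s≤s (s≤s (s≤s _))) (s≤s (s≤s (s≤s _))) =
  subst (λ N → Σ (Graph N) (λ G → PseudoSplit G × MinimalObstruction (3 + c′) (3 + i′) G)) vertex-count
    (G , pseudo-split , minimal-obstruction)
  where
  open TightExample c′ i′
  vertex-count : 5 + ((2 + c′) + (2 + i′)) ≡ (3 + c′) + (3 + i′) + 3
  vertex-count =
    solve 2 (λ c i → con 5 :+ ((con 2 :+ c) :+ (con 2 :+ i)) := (con 3 :+ c) :+ (con 3 :+ i) :+ con 3) refl c′ i′
    where open +-*-Solver

mainTheorem6 : ∀ (s k : ℕ) → 3 ≤ s → 3 ≤ k →
    (∀ (n : ℕ) (G : Graph n) → PseudoSplit G → MinimalObstruction s k G →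
       n ≤ s + k + 3)
    × Σ (Graph (s + k + 3)) (λ G → PseudoSplit G × MinimalObstruction s k G)
mainTheorem6 s k 3≤s 3≤k = (λ _ G → minimal-obstruction-bound 3≤s 3≤k G) , tight-example 3≤s 3≤k
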